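{- For all positive integers $n$ and $j$, \[ \sum_{k=0}^{\lfloor n/2\rfloor}\binom{n}{2k}(5F_j^2)^k\left(\frac{F_{j(n-2k+1)}}{n-2k+1}B_{2k}-\frac{F_jL_j^{n-2k}}{2^n}\right)=0, \] \[ \sum_{k=0}^{\lfloor n/2\rfloor}\binom{n}{2k}\frac{(5F_j^2)^k}{2k+1}\left(\frac{4^{k+1}-1}{k+1}L_{j(n-2k)}B_{2k+2}-\frac{L_j^{n-2k}}{2^n}\right)=0. \]
   Context: $F_n$ and $L_n$ denote the Fibonacci and Lucas numbers: $F_0=0,F_1=1$, $L_0=2,L_1=1$, and $u_n=u_{n-1}+u_{n-2}$. The Bernoulli numbers $B_n$ are defined by $\sum_{n\ge0}B_n\frac{z^n}{n!}=\frac{z}{e^z-1}$. -}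

module Defs where

open import Data.Nat as ℕ using (ℕ; zero; suc; _∸_; _/_)
open import Data.Nat.Combinatorics using (_C_)
open import Data.Integer using (+_)
open import Data.Rational as ℚ using (ℚ; 0ℚ; 1ℚ; _+_; _*_; -_; _-_)
open import Data.List using (List; []; _∷_; map; upTo; zipWith; reverse)

⟦_⟧ : ℕ → ℚ
⟦ n ⟧ = (+ n) ℚ./ 1

_^ℚ_ : ℚ → ℕ → ℚ
x ^ℚ zero = 1ℚ
x ^ℚ suc n = x * (x ^ℚ n)

sumℚ : List ℚ → ℚ
sumℚ [] = 0ℚ
sumℚ (x ∷ xs) = x + sumℚ xs

Σ[0…_] : ℕ → (ℕ → ℚ) → ℚ
Σ[0… m ] f = sumℚ (map f (upTo (suc m)))

fib : ℕ → ℕ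
fib 0 = 0
fib 1 = 1
fib (suc (suc n)) = fib (suc n) ℕ.+ fib n

lucas : ℕ → ℕ
lucas 0 = 2
lucas 1 = 1
lucas (suc (suc n)) = lucas (suc n) ℕ.+ lucas n

-- Bernoulli numbers with z/(e^z-1) convention (B₁ = -1/2).
-- Comparing coefficients of z^(m+1) in z = (e^z - 1) · Σ B_n z^n/n!
-- gives B₀ = 1 and Σ_{k=0}^{m} C(m+1,k) B_k = 0 for m ≥ 1, i.e.
-- B_m = -(1/(m+1)) Σ_{k=0}^{m-1} C(m+1,k) B_k.
-- bernRev m = [B_m, B_{m-1}, …, B_0]
bernRev : ℕ → List ℚ
bernRev zero = 1ℚ ∷ []
bernRev (suc m) = new ∷ prev
  where
  prev : List ℚ
  prev = bernRev m
  new : ℚ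
  new = - ((+ 1 ℚ./ suc (suc m)) *
          sumℚ (zipWith (λ k b → ⟦ suc (suc m) C k ⟧ * b) (upTo (suc m)) (reverse prev)))

bernoulli : ℕ → ℚ
bernoulli m with bernRev m
... | [] = 0ℚ
... | b ∷ _ = b

-- Work in ℚ(√5) with α = φ^j, β = ψ^j and d = α − β = F_j √5, so that α^r + β^r = L_{jr} and
-- α^r − β^r = F_{jr} √5. If Σ_k C(r,k) c_k = σ c_r + [r = 1] τ for all r, the homogenised Appell
-- polynomial P_m(x, e) = Σ_i C(m,i) c_i e^i x^(m−i) satisfies P_m(x + e, e) = σ P_m(x, e) + m τ x^(m−1) e;
-- the Bernoulli numbers do so with σ = τ = 1, the Genocchi numbers 2(1 − 2^k) B_k with σ = −1, τ = 2.
-- Shifting from β to α by d and from α to β by −d and adding keeps only the even powers d^(2k) = (5F_j²)^k,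
-- which evaluates the Bernoulli part of the first identity as F_j L_{jn}/2 and the Genocchi part of the
-- second as F_{j(n+1)} / ((n + 1) F_j). The binomial expansions of α^n + β^n and α^(n+1) − β^(n+1), with
-- α, β = (L_j ± d)/2, give the same values for the remaining parts.

module Submission where

open import Defs
open import Data.Nat using (ℕ; zero; suc; _∸_; _≤_; _<_; z≤n; s≤s; _/_; _!; NonZero)
import Data.Nat as ℕ
import Data.Nat.Properties as ℕₚ
open import Data.Nat.Combinatorics using (_C_; nC1≡n; nCn≡1; nCk≡nC[n∸k]; nCk+nC[k+1]≡[n+1]C[k+1]; nCk≡n!/k![n-k]!; k![n∸k]!∣n!; k>n⇒nCk≡0)
open import Data.Nat.DivMod using (m/n≡1+[m∸n]/n; m/n*n≡m; m/n*n≤m)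
open import Data.Nat.Induction using (<-rec)
open import Data.Nat.Solver renaming (module +-*-Solver to ℕ-Solver)
open import Data.Integer as ℤ using (+_)
import Data.Integer.Properties as ℤₚ
open import Data.Rational using (ℚ; 0ℚ; 1ℚ; _+_; _*_; -_; _-_; toℚᵘ)
import Data.Rational as ℚ
import Data.Rational.Properties as ℚₚ
import Data.Rational.Unnormalised as ℚᵘ
import Data.Rational.Unnormalised.Properties as ℚᵘₚ
open import Data.Rational.Solver renaming (module +-*-Solver to ℚ-Solver)
open import Data.List using (_∷_; upTo; applyUpTo; applyDownFrom; reverse; zipWith; _∷ʳ_)
import Data.List.Properties as List
open import Data.Maybe using (Maybe; just; nothing)
open import Data.Product using (_×_; _,_)
open import Function using (_∘_)
open import Relation.Nullary using (yes; no)
open import Relation.Binary.PropositionalEquality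
open import Algebra.Structures using (IsCommutativeSemiring)
open import Algebra.Structures.Biased using (isCommutativeSemiringˡ)
open import Tactic.RingSolver.Core.AlmostCommutativeRing using (AlmostCommutativeRing)
open import Tactic.RingSolver using (solve-∀)

⟦⟧≃mkℚᵘ : ∀ n → toℚᵘ ⟦ n ⟧ ℚᵘ.≃ ℚᵘ.mkℚᵘ (+ n) 0
⟦⟧≃mkℚᵘ n = ℚₚ.toℚᵘ-fromℚᵘ (ℚᵘ.mkℚᵘ (+ n) 0)

⟦+⟧ : ∀ m n → ⟦ m ℕ.+ n ⟧ ≡ ⟦ m ⟧ + ⟦ n ⟧
⟦+⟧ m n = ℚₚ.toℚᵘ-injective (begin
  toℚᵘ ⟦ m ℕ.+ n ⟧                         ≈⟨ ⟦⟧≃mkℚᵘ (m ℕ.+ n) ⟩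
  ℚᵘ.mkℚᵘ (+ (m ℕ.+ n)) 0                   ≈⟨ ℚᵘ.*≡* numerators ⟩
  ℚᵘ.mkℚᵘ (+ m) 0 ℚᵘ.+ ℚᵘ.mkℚᵘ (+ n) 0       ≈⟨ ℚᵘₚ.+-cong (ℚᵘₚ.≃-sym (⟦⟧≃mkℚᵘ m)) (ℚᵘₚ.≃-sym (⟦⟧≃mkℚᵘ n)) ⟩
  toℚᵘ ⟦ m ⟧ ℚᵘ.+ toℚᵘ ⟦ n ⟧                 ≈⟨ ℚᵘₚ.≃-sym (ℚₚ.toℚᵘ-homo-+ ⟦ m ⟧ ⟦ n ⟧) ⟩
  toℚᵘ (⟦ m ⟧ + ⟦ n ⟧)                      ∎)
  where
  open ℚᵘₚ.≃-Reasoning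
  numerators : + (m ℕ.+ n) ℤ.* + 1 ≡ (+ m ℤ.* + 1 ℤ.+ + n ℤ.* + 1) ℤ.* + 1
  numerators = cong (ℤ._* + 1) (trans (ℤₚ.pos-+ m n) (sym (cong₂ ℤ._+_ (ℤₚ.*-identityʳ (+ m)) (ℤₚ.*-identityʳ (+ n)))))

⟦*⟧ : ∀ m n → ⟦ m ℕ.* n ⟧ ≡ ⟦ m ⟧ * ⟦ n ⟧
⟦*⟧ m n = ℚₚ.toℚᵘ-injective (begin
  toℚᵘ ⟦ m ℕ.* n ⟧                         ≈⟨ ⟦⟧≃mkℚᵘ (m ℕ.* n) ⟩
  ℚᵘ.mkℚᵘ (+ (m ℕ.* n)) 0                   ≈⟨ ℚᵘ.*≡* numerators ⟩
  ℚᵘ.mkℚᵘ (+ m) 0 ℚᵘ.* ℚᵘ.mkℚᵘ (+ n) 0       ≈⟨ ℚᵘₚ.*-cong (ℚᵘₚ.≃-sym (⟦⟧≃mkℚᵘ m)) (ℚᵘₚ.≃-sym (⟦⟧≃mkℚᵘ n)) ⟩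
  toℚᵘ ⟦ m ⟧ ℚᵘ.* toℚᵘ ⟦ n ⟧                 ≈⟨ ℚᵘₚ.≃-sym (ℚₚ.toℚᵘ-homo-* ⟦ m ⟧ ⟦ n ⟧) ⟩
  toℚᵘ (⟦ m ⟧ * ⟦ n ⟧)                      ∎)
  where
  open ℚᵘₚ.≃-Reasoning
  numerators : + (m ℕ.* n) ℤ.* + 1 ≡ (+ m ℤ.* + n) ℤ.* + 1
  numerators = cong (ℤ._* + 1) (ℤₚ.pos-* m n)

/-*-cancel : ∀ p q .{{_ : NonZero q}} → ((+ p) ℚ./ q) * ⟦ q ⟧ ≡ ⟦ p ⟧
/-*-cancel p q@(suc q-1) = ℚₚ.toℚᵘ-injective (begin
  toℚᵘ ((+ p ℚ./ q) * ⟦ q ⟧)                 ≈⟨ ℚₚ.toℚᵘ-homo-* (+ p ℚ./ q) ⟦ q ⟧ ⟩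
  toℚᵘ (+ p ℚ./ q) ℚᵘ.* toℚᵘ ⟦ q ⟧           ≈⟨ ℚᵘₚ.*-cong (ℚₚ.toℚᵘ-fromℚᵘ (ℚᵘ.mkℚᵘ (+ p) q-1)) (⟦⟧≃mkℚᵘ q) ⟩
  ℚᵘ.mkℚᵘ (+ p) q-1 ℚᵘ.* ℚᵘ.mkℚᵘ (+ q) 0     ≈⟨ ℚᵘ.*≡* numerators ⟩
  ℚᵘ.mkℚᵘ (+ p) 0                           ≈⟨ ℚᵘₚ.≃-sym (⟦⟧≃mkℚᵘ p) ⟩
  toℚᵘ ⟦ p ⟧                                ∎)
  where
  open ℚᵘₚ.≃-Reasoning
  numerators : (+ p ℤ.* + q) ℤ.* + 1 ≡ + p ℤ.* + (q ℕ.* 1)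
  numerators = trans (ℤₚ.*-identityʳ _) (cong (λ r → + p ℤ.* + r) (sym (ℕₚ.*-identityʳ q)))

open ≡-Reasoning

[k+1]*[n+1]C[k+1]≡[n+1]*nCk : ∀ n k → suc k ℕ.* (suc n C suc k) ≡ suc n ℕ.* (n C k)
[k+1]*[n+1]C[k+1]≡[n+1]*nCk zero zero = refl
[k+1]*[n+1]C[k+1]≡[n+1]*nCk zero (suc k) = ℕₚ.*-zeroʳ (suc (suc k))
[k+1]*[n+1]C[k+1]≡[n+1]*nCk (suc n) zero = begin
  1 ℕ.* (suc (suc n) C 1) ≡⟨ ℕₚ.*-identityˡ _ ⟩
  suc (suc n) C 1         ≡⟨ nC1≡n (suc (suc n)) ⟩
  suc (suc n)             ≡⟨ ℕₚ.*-identityʳ _ ⟨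
  suc (suc n) ℕ.* 1       ∎
[k+1]*[n+1]C[k+1]≡[n+1]*nCk (suc n) (suc k) = begin
  suc (suc k) ℕ.* (suc (suc n) C suc (suc k))      ≡⟨ cong (suc (suc k) ℕ.*_) (nCk+nC[k+1]≡[n+1]C[k+1] (suc n) (suc k)) ⟨
  suc (suc k) ℕ.* (A ℕ.+ B)                        ≡⟨ solve 3 (λ k A B → (con 2 :+ k) :* (A :+ B) := A :+ (con 1 :+ k) :* A :+ (con 2 :+ k) :* B) refl k A B ⟩
  A ℕ.+ suc k ℕ.* A ℕ.+ suc (suc k) ℕ.* B          ≡⟨ cong₂ (λ u v → A ℕ.+ u ℕ.+ v) ([k+1]*[n+1]C[k+1]≡[n+1]*nCk n k) ([k+1]*[n+1]C[k+1]≡[n+1]*nCk n (suc k)) ⟩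
  A ℕ.+ suc n ℕ.* (n C k) ℕ.+ suc n ℕ.* (n C suc k) ≡⟨ solve 4 (λ A n x y → A :+ (con 1 :+ n) :* x :+ (con 1 :+ n) :* y := A :+ (con 1 :+ n) :* (x :+ y)) refl A n (n C k) (n C suc k) ⟩
  A ℕ.+ suc n ℕ.* (n C k ℕ.+ n C suc k)             ≡⟨ cong (λ u → A ℕ.+ suc n ℕ.* u) (nCk+nC[k+1]≡[n+1]C[k+1] n k) ⟩
  suc (suc n) ℕ.* A                                ∎
  where
  open ℕ-Solver
  A = suc n C suc k
  B = suc n C suc (suc k)

[n+1]Ck*[n+1∸k]≡nCk*[n+1] : ∀ n k → k ≤ n → (suc n C k) ℕ.* suc (n ∸ k) ≡ (n C k) ℕ.* suc n
[n+1]Ck*[n+1∸k]≡nCk*[n+1] n k k≤n = begin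
  (suc n C k) ℕ.* suc (n ∸ k)               ≡⟨ cong (ℕ._* suc (n ∸ k)) (nCk≡nC[n∸k] (ℕₚ.m≤n⇒m≤1+n k≤n)) ⟩
  (suc n C (suc n ∸ k)) ℕ.* suc (n ∸ k)     ≡⟨ cong (λ z → (suc n C z) ℕ.* suc (n ∸ k)) (ℕₚ.+-∸-assoc 1 k≤n) ⟩
  (suc n C suc (n ∸ k)) ℕ.* suc (n ∸ k)     ≡⟨ ℕₚ.*-comm (suc n C suc (n ∸ k)) (suc (n ∸ k)) ⟩
  suc (n ∸ k) ℕ.* (suc n C suc (n ∸ k))     ≡⟨ [k+1]*[n+1]C[k+1]≡[n+1]*nCk n (n ∸ k) ⟩
  suc n ℕ.* (n C (n ∸ k))                   ≡⟨ cong (suc n ℕ.*_) (nCk≡nC[n∸k] k≤n) ⟨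
  suc n ℕ.* (n C k)                         ≡⟨ ℕₚ.*-comm (suc n) (n C k) ⟩
  (n C k) ℕ.* suc n                         ∎

nCk*[k!*[n∸k]!]≡n! : ∀ {n k} → k ≤ n → (n C k) ℕ.* (k ! ℕ.* (n ∸ k) !) ≡ n !
nCk*[k!*[n∸k]!]≡n! {n} {k} k≤n = begin
  (n C k) ℕ.* (k ! ℕ.* (n ∸ k) !)                         ≡⟨ cong (ℕ._* (k ! ℕ.* (n ∸ k) !)) (nCk≡n!/k![n-k]! k≤n) ⟩
  (n ! / (k ! ℕ.* (n ∸ k) !)) ℕ.* (k ! ℕ.* (n ∸ k) !)     ≡⟨ m/n*n≡m (k![n∸k]!∣n! k≤n) ⟩
  n !                                                     ∎
  where instance _ = k ℕₚ.!* (n ∸ k) !≢0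

mCk*[m∸k]Ci≡mCi*[m∸i]Ck : ∀ m k i → k ℕ.+ i ≤ m → (m C k) ℕ.* ((m ∸ k) C i) ≡ (m C i) ℕ.* ((m ∸ i) C k)
mCk*[m∸k]Ci≡mCi*[m∸i]Ck m k i k+i≤m = ℕₚ.*-cancelʳ-≡ _ _ (k ! ℕ.* (i ! ℕ.* r !)) (begin
  (m C k) ℕ.* ((m ∸ k) C i) ℕ.* (k ! ℕ.* (i ! ℕ.* r !))       ≡⟨ solve 5 (λ a b x y z → a :* b :* (x :* (y :* z)) := a :* (x :* (b :* (y :* z)))) refl (m C k) ((m ∸ k) C i) (k !) (i !) (r !) ⟩
  (m C k) ℕ.* (k ! ℕ.* (((m ∸ k) C i) ℕ.* (i ! ℕ.* r !)))     ≡⟨ cong (λ u → (m C k) ℕ.* (k ! ℕ.* u)) (nCk*[k!*[n∸k]!]≡n! i≤m∸k) ⟩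
  (m C k) ℕ.* (k ! ℕ.* (m ∸ k) !)                             ≡⟨ nCk*[k!*[n∸k]!]≡n! k≤m ⟩
  m !                                                         ≡⟨ nCk*[k!*[n∸k]!]≡n! i≤m ⟨
  (m C i) ℕ.* (i ! ℕ.* (m ∸ i) !)                             ≡⟨ cong (λ u → (m C i) ℕ.* (i ! ℕ.* u)) (nCk*[k!*[n∸k]!]≡n! k≤m∸i) ⟨
  (m C i) ℕ.* (i ! ℕ.* (((m ∸ i) C k) ℕ.* (k ! ℕ.* (m ∸ i ∸ k) !))) ≡⟨ cong (λ u → (m C i) ℕ.* (i ! ℕ.* (((m ∸ i) C k) ℕ.* (k ! ℕ.* u !)))) m∸i∸k≡r ⟩
  (m C i) ℕ.* (i ! ℕ.* (((m ∸ i) C k) ℕ.* (k ! ℕ.* r !)))     ≡⟨ solve 5 (λ a b x y z → a :* (y :* (b :* (x :* z))) := a :* b :* (x :* (y :* z))) refl (m C i) ((m ∸ i) C k) (k !) (i !) (r !) ⟩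
  (m C i) ℕ.* ((m ∸ i) C k) ℕ.* (k ! ℕ.* (i ! ℕ.* r !))       ∎)
  where
  open ℕ-Solver
  r = m ∸ k ∸ i
  instance _ = ℕₚ.m*n≢0 (k !) (i ! ℕ.* r !) {{k ℕₚ.!≢0}} {{i ℕₚ.!* r !≢0}}
  k≤m : k ≤ m
  k≤m = ℕₚ.≤-trans (ℕₚ.m≤m+n k i) k+i≤m
  i≤m : i ≤ m
  i≤m = ℕₚ.≤-trans (ℕₚ.m≤n+m i k) k+i≤m
  i≤m∸k : i ≤ m ∸ k
  i≤m∸k = ℕₚ.m+n≤o⇒m≤o∸n i (subst (_≤ m) (ℕₚ.+-comm k i) k+i≤m)
  k≤m∸i : k ≤ m ∸ i
  k≤m∸i = ℕₚ.m+n≤o⇒m≤o∸n k k+i≤m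
  m∸i∸k≡r : m ∸ i ∸ k ≡ r
  m∸i∸k≡r = trans (ℕₚ.∸-+-assoc m i k) (trans (cong (m ∸_) (ℕₚ.+-comm i k)) (sym (ℕₚ.∸-+-assoc m k i)))

[n+1]Cn≡n+1 : ∀ n → suc n C n ≡ suc n
[n+1]Cn≡n+1 n = begin
  suc n C n               ≡⟨ nCk≡nC[n∸k] (ℕₚ.n≤1+n n) ⟩
  suc n C (suc n ∸ n)     ≡⟨ cong (suc n C_) (ℕₚ.+-∸-assoc 1 (ℕₚ.≤-refl {n})) ⟩
  suc n C suc (n ∸ n)     ≡⟨ cong (λ r → suc n C suc r) (ℕₚ.n∸n≡0 n) ⟩
  suc n C 1               ≡⟨ nC1≡n (suc n) ⟩
  suc n                   ∎

infixl 6 _⊕_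
infixl 7 _⊗_
infix 8 ⊝_
infix 5 _+√5·_

data ℚ√5 : Set where
  _+√5·_ : ℚ → ℚ → ℚ√5

_⊕_ : ℚ√5 → ℚ√5 → ℚ√5
(a +√5· b) ⊕ (c +√5· d) = a + c +√5· (b + d)

_⊗_ : ℚ√5 → ℚ√5 → ℚ√5
(a +√5· b) ⊗ (c +√5· d) = a * c + ⟦ 5 ⟧ * (b * d) +√5· (a * d + b * c)

⊝_ : ℚ√5 → ℚ√5
⊝ (a +√5· b) = - a +√5· - b

𝟘 𝟙 : ℚ√5
𝟘 = 0ℚ +√5· 0ℚ
𝟙 = 1ℚ +√5· 0ℚ

open ℚ-Solver using (_:+_; _:*_; :-_; _:=_; con)

√5-cong : ∀ {a b c d} → a ≡ c → b ≡ d → a +√5· b ≡ c +√5· d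
√5-cong refl refl = refl

⊕-assoc : ∀ x y z → (x ⊕ y) ⊕ z ≡ x ⊕ (y ⊕ z)
⊕-assoc (a +√5· b) (c +√5· d) (e +√5· f) = √5-cong (ℚₚ.+-assoc a c e) (ℚₚ.+-assoc b d f)

⊕-comm : ∀ x y → x ⊕ y ≡ y ⊕ x
⊕-comm (a +√5· b) (c +√5· d) = √5-cong (ℚₚ.+-comm a c) (ℚₚ.+-comm b d)

⊕-identityˡ : ∀ x → 𝟘 ⊕ x ≡ x
⊕-identityˡ (a +√5· b) = √5-cong (ℚₚ.+-identityˡ a) (ℚₚ.+-identityˡ b)

⊗-comm : ∀ x y → x ⊗ y ≡ y ⊗ x
⊗-comm (a +√5· b) (c +√5· d) = √5-cong
  (ℚ-Solver.solve 4 (λ a b c d → a :* c :+ con ⟦ 5 ⟧ :* (b :* d) := c :* a :+ con ⟦ 5 ⟧ :* (d :* b)) refl a b c d)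
  (ℚ-Solver.solve 4 (λ a b c d → a :* d :+ b :* c := c :* b :+ d :* a) refl a b c d)

⊗-assoc : ∀ x y z → (x ⊗ y) ⊗ z ≡ x ⊗ (y ⊗ z)
⊗-assoc (a +√5· b) (c +√5· d) (e +√5· f) = √5-cong
  (ℚ-Solver.solve 6 (λ a b c d e f → (a :* c :+ con ⟦ 5 ⟧ :* (b :* d)) :* e :+ con ⟦ 5 ⟧ :* ((a :* d :+ b :* c) :* f)
     := a :* (c :* e :+ con ⟦ 5 ⟧ :* (d :* f)) :+ con ⟦ 5 ⟧ :* (b :* (c :* f :+ d :* e))) refl a b c d e f)
  (ℚ-Solver.solve 6 (λ a b c d e f → (a :* c :+ con ⟦ 5 ⟧ :* (b :* d)) :* f :+ (a :* d :+ b :* c) :* e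
     := a :* (c :* f :+ d :* e) :+ b :* (c :* e :+ con ⟦ 5 ⟧ :* (d :* f))) refl a b c d e f)

⊗-identityˡ : ∀ x → 𝟙 ⊗ x ≡ x
⊗-identityˡ (a +√5· b) = √5-cong
  (ℚ-Solver.solve 2 (λ a b → con 1ℚ :* a :+ con ⟦ 5 ⟧ :* (con 0ℚ :* b) := a) refl a b)
  (ℚ-Solver.solve 2 (λ a b → con 1ℚ :* b :+ con 0ℚ :* a := b) refl a b)

⊗-distribʳ-⊕ : ∀ x y z → (y ⊕ z) ⊗ x ≡ y ⊗ x ⊕ z ⊗ x
⊗-distribʳ-⊕ (a +√5· b) (c +√5· d) (e +√5· f) = √5-cong
  (ℚ-Solver.solve 6 (λ a b c d e f → (c :+ e) :* a :+ con ⟦ 5 ⟧ :* ((d :+ f) :* b)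
     := (c :* a :+ con ⟦ 5 ⟧ :* (d :* b)) :+ (e :* a :+ con ⟦ 5 ⟧ :* (f :* b))) refl a b c d e f)
  (ℚ-Solver.solve 6 (λ a b c d e f → (c :+ e) :* b :+ (d :+ f) :* a
     := (c :* b :+ d :* a) :+ (e :* b :+ f :* a)) refl a b c d e f)

⊗-zeroˡ : ∀ x → 𝟘 ⊗ x ≡ 𝟘
⊗-zeroˡ (a +√5· b) = √5-cong
  (ℚ-Solver.solve 2 (λ a b → con 0ℚ :* a :+ con ⟦ 5 ⟧ :* (con 0ℚ :* b) := con 0ℚ) refl a b)
  (ℚ-Solver.solve 2 (λ a b → con 0ℚ :* b :+ con 0ℚ :* a := con 0ℚ) refl a b)

⊝-distribˡ-⊗ : ∀ x y → ⊝ x ⊗ y ≡ ⊝ (x ⊗ y)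
⊝-distribˡ-⊗ (a +√5· b) (c +√5· d) = √5-cong
  (ℚ-Solver.solve 4 (λ a b c d → (:- a) :* c :+ con ⟦ 5 ⟧ :* ((:- b) :* d) := :- (a :* c :+ con ⟦ 5 ⟧ :* (b :* d))) refl a b c d)
  (ℚ-Solver.solve 4 (λ a b c d → (:- a) :* d :+ (:- b) :* c := :- (a :* d :+ b :* c)) refl a b c d)

⊝-distrib-⊕ : ∀ x y → ⊝ x ⊕ ⊝ y ≡ ⊝ (x ⊕ y)
⊝-distrib-⊕ (a +√5· b) (c +√5· d) = √5-cong (sym (ℚₚ.neg-distrib-+ a c)) (sym (ℚₚ.neg-distrib-+ b d))

isCommutativeSemiring : IsCommutativeSemiring _≡_ _⊕_ _⊗_ 𝟘 𝟙
isCommutativeSemiring = isCommutativeSemiringˡ record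
  { +-isCommutativeMonoid = record
    { isMonoid = record
      { isSemigroup = record { isMagma = record { isEquivalence = isEquivalence ; ∙-cong = cong₂ _⊕_ } ; assoc = ⊕-assoc }
      ; identity = ⊕-identityˡ , λ x → trans (⊕-comm x 𝟘) (⊕-identityˡ x) }
    ; comm = ⊕-comm }
  ; *-isCommutativeMonoid = record
    { isMonoid = record
      { isSemigroup = record { isMagma = record { isEquivalence = isEquivalence ; ∙-cong = cong₂ _⊗_ } ; assoc = ⊗-assoc }
      ; identity = ⊗-identityˡ , λ x → trans (⊗-comm x 𝟙) (⊗-identityˡ x) }
    ; comm = ⊗-comm }
  ; distribʳ = ⊗-distribʳ-⊕
  ; zeroˡ = ⊗-zeroˡ }

𝟘≟_ : ∀ x → Maybe (𝟘 ≡ x)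
𝟘≟ (a +√5· b) with 0ℚ ℚₚ.≟ a | 0ℚ ℚₚ.≟ b
... | yes refl | yes refl = just refl
... | _ | _ = nothing

ℚ√5-ring : AlmostCommutativeRing _ _
ℚ√5-ring = record
  { Carrier = ℚ√5 ; _≈_ = _≡_ ; _+_ = _⊕_ ; _*_ = _⊗_ ; -_ = ⊝_ ; 0# = 𝟘 ; 0≟_ = 𝟘≟_ ; 1# = 𝟙
  ; isAlmostCommutativeRing = record
    { isCommutativeSemiring = isCommutativeSemiring ; -‿cong = cong ⊝_
    ; -‿*-distribˡ = ⊝-distribˡ-⊗ ; -‿+-comm = ⊝-distrib-⊕ } }

open AlmostCommutativeRing ℚ√5-ring public using ()
  renaming (distribˡ to ⊗-distribˡ-⊕; zeroʳ to ⊗-zeroʳ; *-identityʳ to ⊗-identityʳ; +-identityʳ to ⊕-identityʳ)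

⊕-cancelˡ : ∀ a {x y} → a ⊕ x ≡ a ⊕ y → x ≡ y
⊕-cancelˡ a {x} {y} eq = begin
  x                ≡⟨ unshift a x ⟨
  ⊝ a ⊕ (a ⊕ x)    ≡⟨ cong (⊝ a ⊕_) eq ⟩
  ⊝ a ⊕ (a ⊕ y)    ≡⟨ unshift a y ⟩
  y                ∎
  where
  unshift : ∀ a x → ⊝ a ⊕ (a ⊕ x) ≡ x
  unshift = solve-∀ ℚ√5-ring

⊕-cancelʳ : ∀ {x y} a → x ⊕ a ≡ y ⊕ a → x ≡ y
⊕-cancelʳ {x} {y} a eq = ⊕-cancelˡ a (trans (⊕-comm a x) (trans eq (⊕-comm y a)))


ι : ℚ → ℚ√5
ι q = q +√5· 0ℚ

ιₙ : ℕ → ℚ√5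
ιₙ n = ι ⟦ n ⟧

√5 : ℚ√5
√5 = 0ℚ +√5· 1ℚ

½ : ℚ
½ = + 1 ℚ./ 2

half : ℚ√5
half = ι ½

ι-injective : ∀ {p q} → ι p ≡ ι q → p ≡ q
ι-injective refl = refl

ι-* : ∀ p q → ι (p * q) ≡ ι p ⊗ ι q
ι-* p q = √5-cong
  (ℚ-Solver.solve 2 (λ p q → p :* q := p :* q :+ con ⟦ 5 ⟧ :* (con 0ℚ :* con 0ℚ)) refl p q)
  (ℚ-Solver.solve 2 (λ p q → con 0ℚ := p :* con 0ℚ :+ con 0ℚ :* q) refl p q)

ιₙ-+ : ∀ m n → ιₙ (m ℕ.+ n) ≡ ιₙ m ⊕ ιₙ n
ιₙ-+ m n = cong ι (⟦+⟧ m n)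

ιₙ-* : ∀ m n → ιₙ (m ℕ.* n) ≡ ιₙ m ⊗ ιₙ n
ιₙ-* m n = trans (cong ι (⟦*⟧ m n)) (ι-* ⟦ m ⟧ ⟦ n ⟧)

infixr 8 _^_

_^_ : ℚ√5 → ℕ → ℚ√5
x ^ zero = 𝟙
x ^ suc n = x ⊗ x ^ n

^-+ : ∀ x m n → x ^ (m ℕ.+ n) ≡ x ^ m ⊗ x ^ n
^-+ x zero n = sym (⊗-identityˡ _)
^-+ x (suc m) n = trans (cong (x ⊗_) (^-+ x m n)) (sym (⊗-assoc x (x ^ m) (x ^ n)))

^-* : ∀ x m n → x ^ (m ℕ.* n) ≡ (x ^ m) ^ n
^-* x m zero = cong (x ^_) (ℕₚ.*-zeroʳ m)
^-* x m (suc n) = begin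
  x ^ (m ℕ.* suc n)       ≡⟨ cong (x ^_) (ℕₚ.*-suc m n) ⟩
  x ^ (m ℕ.+ m ℕ.* n)     ≡⟨ ^-+ x m (m ℕ.* n) ⟩
  x ^ m ⊗ x ^ (m ℕ.* n)   ≡⟨ cong (x ^ m ⊗_) (^-* x m n) ⟩
  x ^ m ⊗ (x ^ m) ^ n     ∎

^-2* : ∀ x k → x ^ (2 ℕ.* k) ≡ (x ⊗ x) ^ k
^-2* x k = trans (^-* x 2 k) (cong (λ y → (x ⊗ y) ^ k) (trans (⊗-comm x 𝟙) (⊗-identityˡ x)))

⊗-^ : ∀ x y n → (x ⊗ y) ^ n ≡ x ^ n ⊗ y ^ n
⊗-^ x y zero = sym (⊗-identityˡ 𝟙)
⊗-^ x y (suc n) = trans (cong ((x ⊗ y) ⊗_) (⊗-^ x y n)) (interchange x y (x ^ n) (y ^ n))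
  where
  interchange : ∀ x y a b → (x ⊗ y) ⊗ (a ⊗ b) ≡ (x ⊗ a) ⊗ (y ⊗ b)
  interchange = solve-∀ ℚ√5-ring

ι-^ : ∀ q n → ι (q ^ℚ n) ≡ ι q ^ n
ι-^ q zero = refl
ι-^ q (suc n) = trans (ι-* q (q ^ℚ n)) (cong (ι q ⊗_) (ι-^ q n))

ιₙ-^ : ∀ m n → ιₙ (m ℕ.^ n) ≡ ιₙ m ^ n
ιₙ-^ m zero = refl
ιₙ-^ m (suc n) = trans (ιₙ-* m (m ℕ.^ n)) (cong (ιₙ m ⊗_) (ιₙ-^ m n))

ι[1/n]⊗ιₙn≡𝟙 : ∀ n .{{_ : NonZero n}} → ι (+ 1 ℚ./ n) ⊗ ιₙ n ≡ 𝟙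
ι[1/n]⊗ιₙn≡𝟙 n = trans (sym (ι-* (+ 1 ℚ./ n) ⟦ n ⟧)) (cong ι (/-*-cancel 1 n))

ιₙ-cancelˡ : ∀ n .{{_ : NonZero n}} {x y} → ιₙ n ⊗ x ≡ ιₙ n ⊗ y → x ≡ y
ιₙ-cancelˡ n {x} {y} eq = begin
  x                       ≡⟨ cancel x ⟨
  n⁻¹ ⊗ (ιₙ n ⊗ x)        ≡⟨ cong (n⁻¹ ⊗_) eq ⟩
  n⁻¹ ⊗ (ιₙ n ⊗ y)        ≡⟨ cancel y ⟩
  y                       ∎
  where
  n⁻¹ = ι (+ 1 ℚ./ n)
  cancel : ∀ z → n⁻¹ ⊗ (ιₙ n ⊗ z) ≡ z
  cancel z = trans (sym (⊗-assoc n⁻¹ (ιₙ n) z)) (trans (cong (_⊗ z) (ι[1/n]⊗ιₙn≡𝟙 n)) (⊗-identityˡ z))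

√5-cancelˡ : ∀ {x y} → √5 ⊗ x ≡ √5 ⊗ y → x ≡ y
√5-cancelˡ {x} {y} eq = ιₙ-cancelˡ 5 (begin
  ιₙ 5 ⊗ x         ≡⟨ ⊗-assoc √5 √5 x ⟩
  √5 ⊗ (√5 ⊗ x)    ≡⟨ cong (√5 ⊗_) eq ⟩
  √5 ⊗ (√5 ⊗ y)    ≡⟨ ⊗-assoc √5 √5 y ⟨
  ιₙ 5 ⊗ y         ∎)


∑ : ℕ → (ℕ → ℚ√5) → ℚ√5
∑ zero f = 𝟘
∑ (suc n) f = f 0 ⊕ ∑ n (f ∘ suc)

∑-cong-< : ∀ n {f g : ℕ → ℚ√5} → (∀ i → i < n → f i ≡ g i) → ∑ n f ≡ ∑ n g
∑-cong-< zero eq = refl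
∑-cong-< (suc n) eq = cong₂ _⊕_ (eq 0 (s≤s z≤n)) (∑-cong-< n (λ i i<n → eq (suc i) (s≤s i<n)))

∑-cong : ∀ n {f g : ℕ → ℚ√5} → (∀ i → f i ≡ g i) → ∑ n f ≡ ∑ n g
∑-cong n eq = ∑-cong-< n (λ i _ → eq i)

∑-⊕ : ∀ n (f g : ℕ → ℚ√5) → ∑ n (λ i → f i ⊕ g i) ≡ ∑ n f ⊕ ∑ n g
∑-⊕ zero f g = refl
∑-⊕ (suc n) f g = trans (cong (f 0 ⊕ g 0 ⊕_) (∑-⊕ n (f ∘ suc) (g ∘ suc))) (interchange (f 0) (g 0) _ _)
  where
  interchange : ∀ a b c d → a ⊕ b ⊕ (c ⊕ d) ≡ a ⊕ c ⊕ (b ⊕ d)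
  interchange = solve-∀ ℚ√5-ring

∑-⊗ˡ : ∀ n c (f : ℕ → ℚ√5) → c ⊗ ∑ n f ≡ ∑ n (λ i → c ⊗ f i)
∑-⊗ˡ zero c f = trans (⊗-comm c 𝟘) (⊗-zeroˡ c)
∑-⊗ˡ (suc n) c f = trans (⊗-distribˡ-⊕ c (f 0) _) (cong (c ⊗ f 0 ⊕_) (∑-⊗ˡ n c (f ∘ suc)))

∑-⊝ : ∀ n (f : ℕ → ℚ√5) → ∑ n (λ i → ⊝ f i) ≡ ⊝ ∑ n f
∑-⊝ zero f = refl
∑-⊝ (suc n) f = trans (cong (⊝ f 0 ⊕_) (∑-⊝ n (f ∘ suc))) (⊝-distrib-⊕ (f 0) _)

∑-⊖ : ∀ n (f g : ℕ → ℚ√5) → ∑ n (λ i → f i ⊕ ⊝ g i) ≡ ∑ n f ⊕ ⊝ ∑ n g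
∑-⊖ n f g = trans (∑-⊕ n f (λ i → ⊝ g i)) (cong (∑ n f ⊕_) (∑-⊝ n g))

∑-last : ∀ n (f : ℕ → ℚ√5) → ∑ (suc n) f ≡ ∑ n f ⊕ f n
∑-last zero f = ⊕-comm (f 0) 𝟘
∑-last (suc n) f = trans (cong (f 0 ⊕_) (∑-last n (f ∘ suc))) (sym (⊕-assoc (f 0) _ _))

∑-reverse : ∀ n (f : ℕ → ℚ√5) → ∑ n f ≡ ∑ n (λ i → f (n ∸ suc i))
∑-reverse zero f = refl
∑-reverse (suc n) f = begin
  f 0 ⊕ ∑ n (f ∘ suc)                            ≡⟨ cong (f 0 ⊕_) (∑-reverse n (f ∘ suc)) ⟩
  f 0 ⊕ ∑ n (λ i → f (suc (n ∸ suc i)))          ≡⟨ ⊕-comm (f 0) _ ⟩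
  ∑ n (λ i → f (suc (n ∸ suc i))) ⊕ f 0          ≡⟨ cong₂ _⊕_ (∑-cong-< n (λ i i<n → cong f (sym (ℕₚ.+-∸-assoc 1 i<n))))
                                                              (cong f (sym (ℕₚ.n∸n≡0 n))) ⟩
  ∑ n (λ i → f (suc n ∸ suc i)) ⊕ f (n ∸ n)      ≡⟨ ∑-last n (λ i → f (suc n ∸ suc i)) ⟨
  ∑ (suc n) (λ i → f (suc n ∸ suc i))            ∎

∑-⊗ʳ : ∀ n c (f : ℕ → ℚ√5) → ∑ n f ⊗ c ≡ ∑ n (λ i → f i ⊗ c)
∑-⊗ʳ n c f = trans (⊗-comm (∑ n f) c) (trans (∑-⊗ˡ n c f) (∑-cong n (λ i → ⊗-comm c (f i))))

∑-triangle-step : ∀ m (g : ℕ → ℕ → ℚ√5) →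
  ∑ (suc m) (λ k → ∑ (suc m ∸ k) (g k)) ≡ ∑ m (λ k → ∑ (m ∸ k) (g k)) ⊕ ∑ (suc m) (λ k → g k (m ∸ k))
∑-triangle-step m g = begin
  ∑ (suc m) (λ k → ∑ (suc m ∸ k) (g k))                   ≡⟨ ∑-last m _ ⟩
  ∑ m (λ k → ∑ (suc m ∸ k) (g k)) ⊕ ∑ (suc m ∸ m) (g m)   ≡⟨ cong₂ _⊕_ (∑-cong-< m rows) (cong (λ r → ∑ r (g m)) (ℕₚ.+-∸-assoc 1 (ℕₚ.≤-refl {m}))) ⟩
  ∑ m (λ k → ∑ (m ∸ k) (g k) ⊕ g k (m ∸ k)) ⊕ ∑ (suc (m ∸ m)) (g m)
                                                          ≡⟨ cong₂ _⊕_ (∑-⊕ m _ _) (trans (∑-last (m ∸ m) (g m)) (cong (λ r → ∑ r (g m) ⊕ D m) (ℕₚ.n∸n≡0 m))) ⟩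
  (A ⊕ ∑ m D) ⊕ (𝟘 ⊕ D m)                                 ≡⟨ regroup A (∑ m D) (D m) ⟩
  A ⊕ (∑ m D ⊕ D m)                                       ≡⟨ cong (A ⊕_) (∑-last m D) ⟨
  A ⊕ ∑ (suc m) D                                         ∎
  where
  A = ∑ m (λ k → ∑ (m ∸ k) (g k))
  D = λ k → g k (m ∸ k)
  regroup : ∀ a s d → (a ⊕ s) ⊕ (𝟘 ⊕ d) ≡ a ⊕ (s ⊕ d)
  regroup = solve-∀ ℚ√5-ring
  rows : ∀ k → k < m → ∑ (suc m ∸ k) (g k) ≡ ∑ (m ∸ k) (g k) ⊕ g k (m ∸ k)
  rows k k<m = trans (cong (λ r → ∑ r (g k)) (ℕₚ.+-∸-assoc 1 (ℕₚ.<⇒≤ k<m))) (∑-last (m ∸ k) (g k))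

∑-triangle : ∀ m (g : ℕ → ℕ → ℚ√5) → ∑ m (λ k → ∑ (m ∸ k) (g k)) ≡ ∑ m (λ i → ∑ (m ∸ i) (λ k → g k i))
∑-triangle zero g = refl
∑-triangle (suc m) g = begin
  ∑ (suc m) (λ k → ∑ (suc m ∸ k) (g k))                                  ≡⟨ ∑-triangle-step m g ⟩
  ∑ m (λ k → ∑ (m ∸ k) (g k)) ⊕ ∑ (suc m) (λ k → g k (m ∸ k))            ≡⟨ cong₂ _⊕_ (∑-triangle m g) antidiagonal ⟩
  ∑ m (λ i → ∑ (m ∸ i) (λ k → g k i)) ⊕ ∑ (suc m) (λ i → g (m ∸ i) i)    ≡⟨ ∑-triangle-step m (λ i k → g k i) ⟨
  ∑ (suc m) (λ i → ∑ (suc m ∸ i) (λ k → g k i))                          ∎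
  where
  antidiagonal : ∑ (suc m) (λ k → g k (m ∸ k)) ≡ ∑ (suc m) (λ i → g (m ∸ i) i)
  antidiagonal = trans (∑-reverse (suc m) (λ k → g k (m ∸ k)))
    (∑-cong-< (suc m) (λ i i<1+m → cong (g (m ∸ i)) (ℕₚ.m∸[m∸n]≡n (ℕₚ.≤-pred i<1+m))))

∑-binomial-swap : ∀ m (g : ℕ → ℕ → ℚ√5) →
  ∑ (suc m) (λ k → ιₙ (m C k) ⊗ ∑ (suc (m ∸ k)) (λ i → ιₙ ((m ∸ k) C i) ⊗ g k i))
  ≡ ∑ (suc m) (λ i → ιₙ (m C i) ⊗ ∑ (suc (m ∸ i)) (λ k → ιₙ ((m ∸ i) C k) ⊗ g k i))
∑-binomial-swap m g = begin
  ∑ (suc m) (λ k → ιₙ (m C k) ⊗ ∑ (suc (m ∸ k)) (λ i → ιₙ ((m ∸ k) C i) ⊗ g k i))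
    ≡⟨ ∑-cong-< (suc m) (λ k k<1+m → merge g k (ℕₚ.≤-pred k<1+m)) ⟩
  ∑ (suc m) (λ k → ∑ (suc m ∸ k) (λ i → ιₙ ((m C k) ℕ.* ((m ∸ k) C i)) ⊗ g k i))
    ≡⟨ ∑-cong-< (suc m) (λ k k<1+m → ∑-cong-< (suc m ∸ k) (λ i i<1+m∸k →
         cong (λ c → ιₙ c ⊗ g k i) (mCk*[m∸k]Ci≡mCi*[m∸i]Ck m k i (k+i≤m k i k<1+m i<1+m∸k)))) ⟩
  ∑ (suc m) (λ k → ∑ (suc m ∸ k) (λ i → ιₙ ((m C i) ℕ.* ((m ∸ i) C k)) ⊗ g k i))
    ≡⟨ ∑-triangle (suc m) (λ k i → ιₙ ((m C i) ℕ.* ((m ∸ i) C k)) ⊗ g k i) ⟩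
  ∑ (suc m) (λ i → ∑ (suc m ∸ i) (λ k → ιₙ ((m C i) ℕ.* ((m ∸ i) C k)) ⊗ g k i))
    ≡⟨ ∑-cong-< (suc m) (λ i i<1+m → merge (λ i k → g k i) i (ℕₚ.≤-pred i<1+m)) ⟨
  ∑ (suc m) (λ i → ιₙ (m C i) ⊗ ∑ (suc (m ∸ i)) (λ k → ιₙ ((m ∸ i) C k) ⊗ g k i)) ∎
  where
  merge : ∀ (h : ℕ → ℕ → ℚ√5) k → k ≤ m →
    ιₙ (m C k) ⊗ ∑ (suc (m ∸ k)) (λ i → ιₙ ((m ∸ k) C i) ⊗ h k i) ≡ ∑ (suc m ∸ k) (λ i → ιₙ ((m C k) ℕ.* ((m ∸ k) C i)) ⊗ h k i)
  merge h k k≤m = begin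
    ιₙ (m C k) ⊗ ∑ (suc (m ∸ k)) (λ i → ιₙ ((m ∸ k) C i) ⊗ h k i)    ≡⟨ ∑-⊗ˡ (suc (m ∸ k)) (ιₙ (m C k)) (λ i → ιₙ ((m ∸ k) C i) ⊗ h k i) ⟩
    ∑ (suc (m ∸ k)) (λ i → ιₙ (m C k) ⊗ (ιₙ ((m ∸ k) C i) ⊗ h k i))  ≡⟨ ∑-cong (suc (m ∸ k)) (λ i → trans (sym (⊗-assoc (ιₙ (m C k)) (ιₙ ((m ∸ k) C i)) (h k i)))
                                                                          (cong (_⊗ h k i) (sym (ιₙ-* (m C k) ((m ∸ k) C i))))) ⟩
    ∑ (suc (m ∸ k)) (λ i → ιₙ ((m C k) ℕ.* ((m ∸ k) C i)) ⊗ h k i)   ≡⟨ cong (λ r → ∑ r (λ i → ιₙ ((m C k) ℕ.* ((m ∸ k) C i)) ⊗ h k i)) (ℕₚ.+-∸-assoc 1 k≤m) ⟨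
    ∑ (suc m ∸ k) (λ i → ιₙ ((m C k) ℕ.* ((m ∸ k) C i)) ⊗ h k i)     ∎
  k+i≤m : ∀ k i → k < suc m → i < suc m ∸ k → k ℕ.+ i ≤ m
  k+i≤m k i k<1+m i<1+m∸k = ℕₚ.≤-pred (subst (_≤ suc m) (trans (ℕₚ.+-comm (suc i) k) (ℕₚ.+-suc k i))
                                        (ℕₚ.m≤o∸n⇒m+n≤o (suc i) (ℕₚ.<⇒≤ k<1+m) i<1+m∸k))

binomial : ∀ x y n → (x ⊕ y) ^ n ≡ ∑ (suc n) (λ i → ιₙ (n C i) ⊗ (x ^ i ⊗ y ^ (n ∸ i)))
binomial x y zero = refl
binomial x y (suc n) = begin
  (x ⊕ y) ⊗ (x ⊕ y) ^ n                                  ≡⟨ cong ((x ⊕ y) ⊗_) (binomial x y n) ⟩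
  (x ⊕ y) ⊗ ∑ (suc n) (T n)                              ≡⟨ ⊗-distribʳ-⊕ (∑ (suc n) (T n)) x y ⟩
  x ⊗ ∑ (suc n) (T n) ⊕ y ⊗ ∑ (suc n) (T n)              ≡⟨ cong₂ _⊕_ x-part y-part ⟩
  ∑ (suc n) L ⊕ (T (suc n) 0 ⊕ ∑ (suc n) R)              ≡⟨ shuffle (∑ (suc n) L) (T (suc n) 0) (∑ (suc n) R) ⟩
  T (suc n) 0 ⊕ (∑ (suc n) L ⊕ ∑ (suc n) R)              ≡⟨ cong (T (suc n) 0 ⊕_) (∑-⊕ (suc n) L R) ⟨
  T (suc n) 0 ⊕ ∑ (suc n) (λ i → L i ⊕ R i)              ≡⟨ cong (T (suc n) 0 ⊕_) (∑-cong (suc n) pascal) ⟩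
  ∑ (suc (suc n)) (T (suc n))                            ∎
  where
  T : ℕ → ℕ → ℚ√5
  T m i = ιₙ (m C i) ⊗ (x ^ i ⊗ y ^ (m ∸ i))
  L R : ℕ → ℚ√5
  L i = ιₙ (n C i) ⊗ (x ^ suc i ⊗ y ^ (n ∸ i))
  R i = ιₙ (n C suc i) ⊗ (x ^ suc i ⊗ y ^ (n ∸ i))
  U : ℕ → ℚ√5
  U i = ιₙ (n C i) ⊗ (x ^ i ⊗ y ^ (suc n ∸ i))
  shuffle : ∀ a b c → a ⊕ (b ⊕ c) ≡ b ⊕ (a ⊕ c)
  shuffle = solve-∀ ℚ√5-ring
  move-x : ∀ x c a b → x ⊗ (c ⊗ (a ⊗ b)) ≡ c ⊗ ((x ⊗ a) ⊗ b)
  move-x = solve-∀ ℚ√5-ring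
  move-y : ∀ y c a b → y ⊗ (c ⊗ (a ⊗ b)) ≡ c ⊗ (a ⊗ (y ⊗ b))
  move-y = solve-∀ ℚ√5-ring
  x-part : x ⊗ ∑ (suc n) (T n) ≡ ∑ (suc n) L
  x-part = trans (∑-⊗ˡ (suc n) x (T n)) (∑-cong (suc n) (λ i → move-x x (ιₙ (n C i)) (x ^ i) (y ^ (n ∸ i))))
  y-part : y ⊗ ∑ (suc n) (T n) ≡ T (suc n) 0 ⊕ ∑ (suc n) R
  y-part = begin
    y ⊗ ∑ (suc n) (T n)            ≡⟨ ∑-⊗ˡ (suc n) y (T n) ⟩
    ∑ (suc n) (λ i → y ⊗ T n i)    ≡⟨ ∑-cong-< (suc n) (λ i i<1+n → trans (move-y y (ιₙ (n C i)) (x ^ i) (y ^ (n ∸ i)))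
                                        (cong (λ e → ιₙ (n C i) ⊗ (x ^ i ⊗ y ^ e)) (sym (ℕₚ.+-∸-assoc 1 (ℕₚ.≤-pred i<1+n))))) ⟩
    ∑ (suc n) U                    ≡⟨ ⊕-identityʳ (∑ (suc n) U) ⟨
    ∑ (suc n) U ⊕ 𝟘                ≡⟨ cong (∑ (suc n) U ⊕_) (trans (sym (⊗-zeroˡ _)) (cong (λ c → ιₙ c ⊗ (x ^ suc n ⊗ y ^ (n ∸ n))) (sym (k>n⇒nCk≡0 (ℕₚ.n<1+n n))))) ⟩
    ∑ (suc n) U ⊕ U (suc n)        ≡⟨ ∑-last (suc n) U ⟨
    ∑ (suc (suc n)) U              ∎
  pascal : ∀ i → L i ⊕ R i ≡ T (suc n) (suc i)
  pascal i = trans (sym (⊗-distribʳ-⊕ _ (ιₙ (n C i)) (ιₙ (n C suc i))))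
                   (cong (_⊗ (x ^ suc i ⊗ y ^ (n ∸ i))) (trans (sym (ιₙ-+ (n C i) (n C suc i))) (cong ιₙ (nCk+nC[k+1]≡[n+1]C[k+1] n i))))

sign : ℕ → ℚ√5
sign i = (⊝ 𝟙) ^ i

⊝-^ : ∀ x i → (⊝ x) ^ i ≡ sign i ⊗ x ^ i
⊝-^ x i = trans (cong (_^ i) (sym (trans (⊝-distribˡ-⊗ 𝟙 x) (cong ⊝_ (⊗-identityˡ x))))) (⊗-^ (⊝ 𝟙) x i)

∑-even-part : ∀ n (f : ℕ → ℚ√5) → ∑ (suc n) (λ i → f i ⊕ sign i ⊗ f i) ≡ ιₙ 2 ⊗ ∑ (suc (n / 2)) (λ k → f (2 ℕ.* k))
∑-even-part zero f = first (f 0)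
  where
  first : ∀ a → a ⊕ 𝟙 ⊗ a ⊕ 𝟘 ≡ ιₙ 2 ⊗ (a ⊕ 𝟘)
  first = solve-∀ ℚ√5-ring
∑-even-part (suc zero) f = first-two (f 0) (f 1)
  where
  first-two : ∀ a b → a ⊕ 𝟙 ⊗ a ⊕ (b ⊕ (⊝ 𝟙 ⊗ 𝟙) ⊗ b ⊕ 𝟘) ≡ ιₙ 2 ⊗ (a ⊕ 𝟘)
  first-two = solve-∀ ℚ√5-ring
∑-even-part (suc (suc n)) f = begin
  g 0 ⊕ (g 1 ⊕ ∑ (suc n) (λ i → g (2 ℕ.+ i)))                        ≡⟨ cong (λ s → g 0 ⊕ (g 1 ⊕ s)) (∑-cong (suc n) (λ i →
                                                                          cong (λ z → f (2 ℕ.+ i) ⊕ z ⊗ f (2 ℕ.+ i)) (sign-2+ i))) ⟩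
  g 0 ⊕ (g 1 ⊕ ∑ (suc n) (λ i → f (2 ℕ.+ i) ⊕ sign i ⊗ f (2 ℕ.+ i)))  ≡⟨ cong (λ s → g 0 ⊕ (g 1 ⊕ s)) (∑-even-part n (λ i → f (2 ℕ.+ i))) ⟩
  g 0 ⊕ (g 1 ⊕ ιₙ 2 ⊗ S)                                             ≡⟨ collect (f 0) (f 1) S ⟩
  ιₙ 2 ⊗ (f 0 ⊕ S)                                                   ≡⟨ cong (λ s → ιₙ 2 ⊗ (f 0 ⊕ s)) (∑-cong (suc (n / 2)) (λ k → cong f (sym (ℕₚ.*-suc 2 k)))) ⟩
  ιₙ 2 ⊗ ∑ (suc (suc (n / 2))) (λ k → f (2 ℕ.* k))                    ≡⟨ cong (λ q → ιₙ 2 ⊗ ∑ (suc q) (λ k → f (2 ℕ.* k))) (m/n≡1+[m∸n]/n {2 ℕ.+ n} {2} (s≤s (s≤s z≤n))) ⟨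
  ιₙ 2 ⊗ ∑ (suc ((2 ℕ.+ n) / 2)) (λ k → f (2 ℕ.* k))                  ∎
  where
  g : ℕ → ℚ√5
  g i = f i ⊕ sign i ⊗ f i
  S = ∑ (suc (n / 2)) (λ k → f (2 ℕ.+ 2 ℕ.* k))
  sign-2+ : ∀ i → sign (2 ℕ.+ i) ≡ sign i
  sign-2+ i = double-negation (sign i)
    where
    double-negation : ∀ s → ⊝ 𝟙 ⊗ (⊝ 𝟙 ⊗ s) ≡ s
    double-negation = solve-∀ ℚ√5-ring
  collect : ∀ a b s → a ⊕ 𝟙 ⊗ a ⊕ (b ⊕ (⊝ 𝟙 ⊗ 𝟙) ⊗ b ⊕ ιₙ 2 ⊗ s) ≡ ιₙ 2 ⊗ (a ⊕ s)
  collect = solve-∀ ℚ√5-ring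

∑-odd-part : ∀ n (f : ℕ → ℚ√5) → ∑ (suc (suc n)) (λ i → f i ⊕ ⊝ (sign i ⊗ f i)) ≡ ιₙ 2 ⊗ ∑ (suc (n / 2)) (λ k → f (suc (2 ℕ.* k)))
∑-odd-part n f = begin
  (f 0 ⊕ ⊝ (𝟙 ⊗ f 0)) ⊕ ∑ (suc n) (λ i → f (suc i) ⊕ ⊝ ((⊝ 𝟙 ⊗ sign i) ⊗ f (suc i)))
    ≡⟨ cong₂ _⊕_ (cancel (f 0)) (∑-cong (suc n) (λ i → flip (sign i) (f (suc i)))) ⟩
  𝟘 ⊕ ∑ (suc n) (λ i → f (suc i) ⊕ sign i ⊗ f (suc i))    ≡⟨ ⊕-identityˡ _ ⟩
  ∑ (suc n) (λ i → f (suc i) ⊕ sign i ⊗ f (suc i))        ≡⟨ ∑-even-part n (f ∘ suc) ⟩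
  ιₙ 2 ⊗ ∑ (suc (n / 2)) (λ k → f (suc (2 ℕ.* k)))        ∎
  where
  cancel : ∀ a → a ⊕ ⊝ (𝟙 ⊗ a) ≡ 𝟘
  cancel = solve-∀ ℚ√5-ring
  flip : ∀ s a → a ⊕ ⊝ ((⊝ 𝟙 ⊗ s) ⊗ a) ≡ a ⊕ s ⊗ a
  flip = solve-∀ ℚ√5-ring

binomial-⊝ : ∀ h X n → (⊝ h ⊕ X) ^ n ≡ ∑ (suc n) (λ i → sign i ⊗ (ιₙ (n C i) ⊗ (h ^ i ⊗ X ^ (n ∸ i))))
binomial-⊝ h X n = trans (binomial (⊝ h) X n) (∑-cong (suc n) (λ i →
  trans (cong (λ p → ιₙ (n C i) ⊗ (p ⊗ X ^ (n ∸ i))) (⊝-^ h i)) (pull-sign (ιₙ (n C i)) (sign i) (h ^ i) (X ^ (n ∸ i)))))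
  where
  pull-sign : ∀ c s p q → c ⊗ ((s ⊗ p) ⊗ q) ≡ s ⊗ (c ⊗ (p ⊗ q))
  pull-sign = solve-∀ ℚ√5-ring

binomial-even : ∀ h X n → (h ⊕ X) ^ n ⊕ (⊝ h ⊕ X) ^ n ≡
  ιₙ 2 ⊗ ∑ (suc (n / 2)) (λ k → ιₙ (n C (2 ℕ.* k)) ⊗ ((h ⊗ h) ^ k ⊗ X ^ (n ∸ 2 ℕ.* k)))
binomial-even h X n = begin
  (h ⊕ X) ^ n ⊕ (⊝ h ⊕ X) ^ n                        ≡⟨ cong₂ _⊕_ (binomial h X n) (binomial-⊝ h X n) ⟩
  ∑ (suc n) T ⊕ ∑ (suc n) (λ i → sign i ⊗ T i)       ≡⟨ ∑-⊕ (suc n) T (λ i → sign i ⊗ T i) ⟨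
  ∑ (suc n) (λ i → T i ⊕ sign i ⊗ T i)               ≡⟨ ∑-even-part n T ⟩
  ιₙ 2 ⊗ ∑ (suc (n / 2)) (λ k → T (2 ℕ.* k))         ≡⟨ cong (ιₙ 2 ⊗_) (∑-cong (suc (n / 2)) (λ k →
                                                          cong (λ p → ιₙ (n C (2 ℕ.* k)) ⊗ (p ⊗ X ^ (n ∸ 2 ℕ.* k))) (^-2* h k))) ⟩
  ιₙ 2 ⊗ ∑ (suc (n / 2)) (λ k → ιₙ (n C (2 ℕ.* k)) ⊗ ((h ⊗ h) ^ k ⊗ X ^ (n ∸ 2 ℕ.* k))) ∎
  where
  T : ℕ → ℚ√5
  T i = ιₙ (n C i) ⊗ (h ^ i ⊗ X ^ (n ∸ i))

binomial-odd : ∀ h X n → (h ⊕ X) ^ suc n ⊕ ⊝ (⊝ h ⊕ X) ^ suc n ≡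
  ιₙ 2 ⊗ ∑ (suc (n / 2)) (λ k → ιₙ (suc n C suc (2 ℕ.* k)) ⊗ ((h ⊗ (h ⊗ h) ^ k) ⊗ X ^ (n ∸ 2 ℕ.* k)))
binomial-odd h X n = begin
  (h ⊕ X) ^ suc n ⊕ ⊝ (⊝ h ⊕ X) ^ suc n                 ≡⟨ cong₂ (λ p q → p ⊕ ⊝ q) (binomial h X (suc n)) (binomial-⊝ h X (suc n)) ⟩
  ∑ (suc (suc n)) T ⊕ ⊝ ∑ (suc (suc n)) (λ i → sign i ⊗ T i)  ≡⟨ ∑-⊖ (suc (suc n)) T (λ i → sign i ⊗ T i) ⟨
  ∑ (suc (suc n)) (λ i → T i ⊕ ⊝ (sign i ⊗ T i))        ≡⟨ ∑-odd-part n T ⟩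
  ιₙ 2 ⊗ ∑ (suc (n / 2)) (λ k → T (suc (2 ℕ.* k)))      ≡⟨ cong (ιₙ 2 ⊗_) (∑-cong (suc (n / 2)) (λ k →
                                                             cong (λ p → ιₙ (suc n C suc (2 ℕ.* k)) ⊗ ((h ⊗ p) ⊗ X ^ (n ∸ 2 ℕ.* k))) (^-2* h k))) ⟩
  ιₙ 2 ⊗ ∑ (suc (n / 2)) (λ k → ιₙ (suc n C suc (2 ℕ.* k)) ⊗ ((h ⊗ (h ⊗ h) ^ k) ⊗ X ^ (n ∸ 2 ℕ.* k))) ∎
  where
  T : ℕ → ℚ√5
  T i = ιₙ (suc n C i) ⊗ (h ^ i ⊗ X ^ (suc n ∸ i))

δ₁ : ℚ√5 → ℕ → ℚ√5
δ₁ τ 1 = τ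
δ₁ τ _ = 𝟘

∑-δ₁ : ∀ τ m (f : ℕ → ℚ√5) → ∑ (suc (suc m)) (λ i → δ₁ τ (suc m ∸ i) ⊗ f i) ≡ τ ⊗ f m
∑-δ₁ τ zero f = only-first τ (f 0) (f 1)
  where
  only-first : ∀ t a b → t ⊗ a ⊕ (𝟘 ⊗ b ⊕ 𝟘) ≡ t ⊗ a
  only-first = solve-∀ ℚ√5-ring
∑-δ₁ τ (suc m) f = trans (cong₂ _⊕_ (⊗-zeroˡ (f 0)) (∑-δ₁ τ m (f ∘ suc))) (⊕-identityˡ (τ ⊗ f (suc m)))

-- The condition under which the Appell polynomials A_m of c satisfy A_m(x + 1) = σ A_m(x) + m τ x^(m−1).
BinomialRecurrence : (ℕ → ℚ√5) → ℚ√5 → ℚ√5 → Set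
BinomialRecurrence c σ τ = ∀ r → ∑ (suc r) (λ k → ιₙ (r C k) ⊗ c k) ≡ σ ⊗ c r ⊕ δ₁ τ r

appellTerm : ℕ → (ℕ → ℚ√5) → ℚ√5 → ℚ√5 → ℕ → ℚ√5
appellTerm m c x e i = ιₙ (m C i) ⊗ (c i ⊗ (e ^ i ⊗ x ^ (m ∸ i)))

-- e^m A_m(x/e); for c = B this is the homogenised Bernoulli polynomial e^m B_m(x/e).
appell : ℕ → (ℕ → ℚ√5) → ℚ√5 → ℚ√5 → ℚ√5
appell m c x e = ∑ (suc m) (appellTerm m c x e)

appellTerm-expand : ∀ m c x e k → k ≤ m → appellTerm m c (x ⊕ e) e k ≡
  ιₙ (m C k) ⊗ ∑ (suc (m ∸ k)) (λ i → ιₙ ((m ∸ k) C i) ⊗ (c k ⊗ (x ^ i ⊗ e ^ (m ∸ i))))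
appellTerm-expand m c x e k k≤m = begin
  ιₙ (m C k) ⊗ (c k ⊗ (e ^ k ⊗ (x ⊕ e) ^ (m ∸ k)))                                ≡⟨ cong (λ s → ιₙ (m C k) ⊗ (c k ⊗ (e ^ k ⊗ s))) (binomial x e (m ∸ k)) ⟩
  ιₙ (m C k) ⊗ (c k ⊗ (e ^ k ⊗ ∑ (suc (m ∸ k)) T))                                 ≡⟨ cong (λ s → ιₙ (m C k) ⊗ (c k ⊗ s)) (∑-⊗ˡ (suc (m ∸ k)) (e ^ k) T) ⟩
  ιₙ (m C k) ⊗ (c k ⊗ ∑ (suc (m ∸ k)) (λ i → e ^ k ⊗ T i))                         ≡⟨ cong (ιₙ (m C k) ⊗_) (∑-⊗ˡ (suc (m ∸ k)) (c k) (λ i → e ^ k ⊗ T i)) ⟩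
  ιₙ (m C k) ⊗ ∑ (suc (m ∸ k)) (λ i → c k ⊗ (e ^ k ⊗ T i))                         ≡⟨ cong (ιₙ (m C k) ⊗_) (∑-cong-< (suc (m ∸ k)) (λ i i<1+m∸k → term i (ℕₚ.≤-pred i<1+m∸k))) ⟩
  ιₙ (m C k) ⊗ ∑ (suc (m ∸ k)) (λ i → ιₙ ((m ∸ k) C i) ⊗ (c k ⊗ (x ^ i ⊗ e ^ (m ∸ i)))) ∎
  where
  T : ℕ → ℚ√5
  T i = ιₙ ((m ∸ k) C i) ⊗ (x ^ i ⊗ e ^ (m ∸ k ∸ i))
  rearrange : ∀ c p b a q → c ⊗ (p ⊗ (b ⊗ (a ⊗ q))) ≡ b ⊗ (c ⊗ (a ⊗ (p ⊗ q)))
  rearrange = solve-∀ ℚ√5-ring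
  k+[m∸k∸i]≡m∸i : ∀ i → i ≤ m ∸ k → k ℕ.+ (m ∸ k ∸ i) ≡ m ∸ i
  k+[m∸k∸i]≡m∸i i i≤m∸k = begin
    k ℕ.+ (m ∸ k ∸ i)       ≡⟨ cong (k ℕ.+_) (ℕₚ.∸-+-assoc m k i) ⟩
    k ℕ.+ (m ∸ (k ℕ.+ i))   ≡⟨ ℕₚ.+-∸-assoc k (subst (_≤ m) (ℕₚ.+-comm i k) (ℕₚ.m≤o∸n⇒m+n≤o i k≤m i≤m∸k)) ⟨
    k ℕ.+ m ∸ (k ℕ.+ i)     ≡⟨ ℕₚ.[m+n]∸[m+o]≡n∸o k m i ⟩
    m ∸ i                   ∎
  term : ∀ i → i ≤ m ∸ k → c k ⊗ (e ^ k ⊗ T i) ≡ ιₙ ((m ∸ k) C i) ⊗ (c k ⊗ (x ^ i ⊗ e ^ (m ∸ i)))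
  term i i≤m∸k = begin
    c k ⊗ (e ^ k ⊗ T i)                                                 ≡⟨ rearrange (c k) (e ^ k) (ιₙ ((m ∸ k) C i)) (x ^ i) (e ^ (m ∸ k ∸ i)) ⟩
    ιₙ ((m ∸ k) C i) ⊗ (c k ⊗ (x ^ i ⊗ (e ^ k ⊗ e ^ (m ∸ k ∸ i))))       ≡⟨ cong (λ p → ιₙ ((m ∸ k) C i) ⊗ (c k ⊗ (x ^ i ⊗ p))) (^-+ e k (m ∸ k ∸ i)) ⟨
    ιₙ ((m ∸ k) C i) ⊗ (c k ⊗ (x ^ i ⊗ e ^ (k ℕ.+ (m ∸ k ∸ i))))         ≡⟨ cong (λ r → ιₙ ((m ∸ k) C i) ⊗ (c k ⊗ (x ^ i ⊗ e ^ r))) (k+[m∸k∸i]≡m∸i i i≤m∸k) ⟩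
    ιₙ ((m ∸ k) C i) ⊗ (c k ⊗ (x ^ i ⊗ e ^ (m ∸ i)))                   ∎

appell-reflect : ∀ m c x e → ∑ (suc m) (λ i → ιₙ (m C i) ⊗ (c (m ∸ i) ⊗ (x ^ i ⊗ e ^ (m ∸ i)))) ≡ appell m c x e
appell-reflect m c x e = trans (∑-reverse (suc m) (λ i → ιₙ (m C i) ⊗ (c (m ∸ i) ⊗ (x ^ i ⊗ e ^ (m ∸ i))))) (∑-cong-< (suc m) (λ i i<1+m → term i (ℕₚ.≤-pred i<1+m)))
  where
  swap-powers : ∀ a b p q → a ⊗ (b ⊗ (p ⊗ q)) ≡ a ⊗ (b ⊗ (q ⊗ p))
  swap-powers = solve-∀ ℚ√5-ring
  term : ∀ i → i ≤ m → ιₙ (m C (m ∸ i)) ⊗ (c (m ∸ (m ∸ i)) ⊗ (x ^ (m ∸ i) ⊗ e ^ (m ∸ (m ∸ i)))) ≡ appellTerm m c x e i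
  term i i≤m = begin
    ιₙ (m C (m ∸ i)) ⊗ (c (m ∸ (m ∸ i)) ⊗ (x ^ (m ∸ i) ⊗ e ^ (m ∸ (m ∸ i))))  ≡⟨ cong₂ (λ a j → ιₙ a ⊗ (c j ⊗ (x ^ (m ∸ i) ⊗ e ^ j))) (sym (nCk≡nC[n∸k] i≤m)) (ℕₚ.m∸[m∸n]≡n i≤m) ⟩
    ιₙ (m C i) ⊗ (c i ⊗ (x ^ (m ∸ i) ⊗ e ^ i))                              ≡⟨ swap-powers (ιₙ (m C i)) (c i) (x ^ (m ∸ i)) (e ^ i) ⟩
    appellTerm m c x e i                                                  ∎

appell-shift : ∀ {c σ τ} → BinomialRecurrence c σ τ → ∀ m x e →
  appell (suc m) c (x ⊕ e) e ≡ σ ⊗ appell (suc m) c x e ⊕ ιₙ (suc m) ⊗ (τ ⊗ (x ^ m ⊗ e))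
appell-shift {c} {σ} {τ} rec m x e = begin
  appell M c (x ⊕ e) e
    ≡⟨ ∑-cong-< (suc M) (λ k k<1+M → appellTerm-expand M c x e k (ℕₚ.≤-pred k<1+M)) ⟩
  ∑ (suc M) (λ k → ιₙ (M C k) ⊗ ∑ (suc (M ∸ k)) (λ i → ιₙ ((M ∸ k) C i) ⊗ (c k ⊗ Y i)))
    ≡⟨ ∑-binomial-swap M (λ k i → c k ⊗ Y i) ⟩
  ∑ (suc M) (λ i → ιₙ (M C i) ⊗ ∑ (suc (M ∸ i)) (λ k → ιₙ ((M ∸ i) C k) ⊗ (c k ⊗ Y i)))
    ≡⟨ ∑-cong (suc M) (λ i → cong (ιₙ (M C i) ⊗_) (inner i)) ⟩
  ∑ (suc M) (λ i → ιₙ (M C i) ⊗ ((σ ⊗ c (M ∸ i) ⊕ δ₁ τ (M ∸ i)) ⊗ Y i))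
    ≡⟨ ∑-cong (suc M) (λ i → split (ιₙ (M C i)) σ (c (M ∸ i)) (δ₁ τ (M ∸ i)) (Y i)) ⟩
  ∑ (suc M) (λ i → σ ⊗ P i ⊕ δ₁ τ (M ∸ i) ⊗ D i)
    ≡⟨ ∑-⊕ (suc M) (λ i → σ ⊗ P i) (λ i → δ₁ τ (M ∸ i) ⊗ D i) ⟩
  ∑ (suc M) (λ i → σ ⊗ P i) ⊕ ∑ (suc M) (λ i → δ₁ τ (M ∸ i) ⊗ D i)
    ≡⟨ cong₂ _⊕_ (trans (sym (∑-⊗ˡ (suc M) σ P)) (cong (σ ⊗_) (appell-reflect M c x e))) (∑-δ₁ τ m D) ⟩
  σ ⊗ appell M c x e ⊕ τ ⊗ (ιₙ (M C m) ⊗ Y m)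
    ≡⟨ cong (σ ⊗ appell M c x e ⊕_) last ⟩
  σ ⊗ appell M c x e ⊕ ιₙ M ⊗ (τ ⊗ (x ^ m ⊗ e))   ∎
  where
  M = suc m
  Y : ℕ → ℚ√5
  Y i = x ^ i ⊗ e ^ (M ∸ i)
  P D : ℕ → ℚ√5
  P i = ιₙ (M C i) ⊗ (c (M ∸ i) ⊗ Y i)
  D i = ιₙ (M C i) ⊗ Y i
  split : ∀ b s a d y → b ⊗ ((s ⊗ a ⊕ d) ⊗ y) ≡ s ⊗ (b ⊗ (a ⊗ y)) ⊕ d ⊗ (b ⊗ y)
  split = solve-∀ ℚ√5-ring
  move-right : ∀ a b y → a ⊗ (b ⊗ y) ≡ y ⊗ (a ⊗ b)
  move-right = solve-∀ ℚ√5-ring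
  inner : ∀ i → ∑ (suc (M ∸ i)) (λ k → ιₙ ((M ∸ i) C k) ⊗ (c k ⊗ Y i)) ≡ (σ ⊗ c (M ∸ i) ⊕ δ₁ τ (M ∸ i)) ⊗ Y i
  inner i = begin
    ∑ (suc (M ∸ i)) (λ k → ιₙ ((M ∸ i) C k) ⊗ (c k ⊗ Y i))   ≡⟨ ∑-cong (suc (M ∸ i)) (λ k → move-right (ιₙ ((M ∸ i) C k)) (c k) (Y i)) ⟩
    ∑ (suc (M ∸ i)) (λ k → Y i ⊗ (ιₙ ((M ∸ i) C k) ⊗ c k))   ≡⟨ ∑-⊗ˡ (suc (M ∸ i)) (Y i) (λ k → ιₙ ((M ∸ i) C k) ⊗ c k) ⟨
    Y i ⊗ ∑ (suc (M ∸ i)) (λ k → ιₙ ((M ∸ i) C k) ⊗ c k)     ≡⟨ cong (Y i ⊗_) (rec (M ∸ i)) ⟩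
    Y i ⊗ (σ ⊗ c (M ∸ i) ⊕ δ₁ τ (M ∸ i))                     ≡⟨ ⊗-comm (Y i) _ ⟩
    (σ ⊗ c (M ∸ i) ⊕ δ₁ τ (M ∸ i)) ⊗ Y i                     ∎
  last : τ ⊗ (ιₙ (M C m) ⊗ Y m) ≡ ιₙ M ⊗ (τ ⊗ (x ^ m ⊗ e))
  last = begin
    τ ⊗ (ιₙ (M C m) ⊗ (x ^ m ⊗ e ^ (M ∸ m)))   ≡⟨ cong₂ (λ a r → τ ⊗ (ιₙ a ⊗ (x ^ m ⊗ e ^ r))) ([n+1]Cn≡n+1 m) (ℕₚ.+-∸-assoc 1 (ℕₚ.≤-refl {m})) ⟩
    τ ⊗ (ιₙ M ⊗ (x ^ m ⊗ e ^ suc (m ∸ m)))      ≡⟨ cong (λ r → τ ⊗ (ιₙ M ⊗ (x ^ m ⊗ e ^ suc r))) (ℕₚ.n∸n≡0 m) ⟩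
    τ ⊗ (ιₙ M ⊗ (x ^ m ⊗ (e ⊗ 𝟙)))             ≡⟨ tidy τ (ιₙ M) (x ^ m) e ⟩
    ιₙ M ⊗ (τ ⊗ (x ^ m ⊗ e))                   ∎
    where
    tidy : ∀ t a p q → t ⊗ (a ⊗ (p ⊗ (q ⊗ 𝟙))) ≡ a ⊗ (t ⊗ (p ⊗ q))
    tidy = solve-∀ ℚ√5-ring

∑-appell-difference : ∀ m c σ x y e →
  ∑ (suc m) (λ i → appellTerm m c x e i ⊕ ⊝ (σ ⊗ appellTerm m c y e i)) ≡ appell m c x e ⊕ ⊝ (σ ⊗ appell m c y e)
∑-appell-difference m c σ x y e = trans (∑-⊖ (suc m) (appellTerm m c x e) (λ i → σ ⊗ appellTerm m c y e i))
  (cong (λ s → appell m c x e ⊕ ⊝ s) (sym (∑-⊗ˡ (suc m) σ (appellTerm m c y e))))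

-- The i-th term of A_m(x + e) − σ A_m(x), in the homogenised form of appellTerm.
appellShiftTerm : ℕ → (ℕ → ℚ√5) → ℚ√5 → ℚ√5 → ℚ√5 → ℕ → ℚ√5
appellShiftTerm m c σ x e i = ιₙ (m C i) ⊗ (c i ⊗ (e ^ i ⊗ ((x ⊕ e) ^ (m ∸ i) ⊕ ⊝ (σ ⊗ x ^ (m ∸ i)))))

-- Apply appell-shift once at e and once at −e, using x = (x + e) + (−e); when σ² = 1 the terms not involving τ cancel.
appell-shift-alternating : ∀ {c σ τ} → BinomialRecurrence c σ τ → σ ⊗ σ ≡ 𝟙 → ∀ m x e →
  ∑ (suc (suc m)) (λ i → appellShiftTerm (suc m) c σ x e i ⊕ sign i ⊗ appellShiftTerm (suc m) c σ x e i)
  ≡ ιₙ (suc m) ⊗ (τ ⊗ (e ⊗ (x ^ m ⊕ σ ⊗ (x ⊕ e) ^ m)))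
appell-shift-alternating {c} {σ} {τ} rec σ²≡𝟙 m x e = begin
  ∑ (suc M) (λ i → S i ⊕ sign i ⊗ S i)                                         ≡⟨ ∑-⊕ (suc M) S (λ i → sign i ⊗ S i) ⟩
  ∑ (suc M) S ⊕ ∑ (suc M) (λ i → sign i ⊗ S i)                                 ≡⟨ cong₂ _⊕_ (∑-cong (suc M) forward) (∑-cong (suc M) backward) ⟩
  ∑ (suc M) (λ i → appellTerm M c y e i ⊕ ⊝ (σ ⊗ appellTerm M c x e i))
    ⊕ ∑ (suc M) (λ i → appellTerm M c y (⊝ e) i ⊕ ⊝ (σ ⊗ appellTerm M c (y ⊕ ⊝ e) (⊝ e) i))
                                                                               ≡⟨ cong₂ _⊕_ (∑-appell-difference M c σ y x e) (∑-appell-difference M c σ y (y ⊕ ⊝ e) (⊝ e)) ⟩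
  (appell M c y e ⊕ ⊝ (σ ⊗ appell M c x e))
    ⊕ (appell M c y (⊝ e) ⊕ ⊝ (σ ⊗ appell M c (y ⊕ ⊝ e) (⊝ e)))                ≡⟨ cong₂ (λ p q → (p ⊕ ⊝ (σ ⊗ appell M c x e)) ⊕ (appell M c y (⊝ e) ⊕ ⊝ (σ ⊗ q)))
                                                                                     (appell-shift rec m x e) (appell-shift rec m y (⊝ e)) ⟩
  (σ ⊗ appell M c x e ⊕ ιₙ M ⊗ (τ ⊗ (x ^ m ⊗ e)) ⊕ ⊝ (σ ⊗ appell M c x e))
    ⊕ (appell M c y (⊝ e) ⊕ ⊝ (σ ⊗ (σ ⊗ appell M c y (⊝ e) ⊕ ιₙ M ⊗ (τ ⊗ (y ^ m ⊗ ⊝ e)))))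
                                                                               ≡⟨ collect σ (ιₙ M) τ (appell M c x e) (appell M c y (⊝ e)) (x ^ m) (y ^ m) e ⟩
  R ⊕ (𝟙 ⊕ ⊝ (σ ⊗ σ)) ⊗ appell M c y (⊝ e)                                    ≡⟨ cong (λ s → R ⊕ (𝟙 ⊕ ⊝ s) ⊗ appell M c y (⊝ e)) σ²≡𝟙 ⟩
  R ⊕ (𝟙 ⊕ ⊝ 𝟙) ⊗ appell M c y (⊝ e)                                         ≡⟨ vanish R (appell M c y (⊝ e)) ⟩
  R                                                                          ∎
  where
  M = suc m
  y = x ⊕ e
  R = ιₙ M ⊗ (τ ⊗ (e ⊗ (x ^ m ⊕ σ ⊗ y ^ m)))
  S = appellShiftTerm M c σ x e
  y⊖e≡x : y ⊕ ⊝ e ≡ x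
  y⊖e≡x = cancel x e
    where
    cancel : ∀ x e → x ⊕ e ⊕ ⊝ e ≡ x
    cancel = solve-∀ ℚ√5-ring
  expand : ∀ σ b a p q r → b ⊗ (a ⊗ (p ⊗ (q ⊕ ⊝ (σ ⊗ r)))) ≡ b ⊗ (a ⊗ (p ⊗ q)) ⊕ ⊝ (σ ⊗ (b ⊗ (a ⊗ (p ⊗ r))))
  expand = solve-∀ ℚ√5-ring
  expand-signed : ∀ σ s b a p q r → s ⊗ (b ⊗ (a ⊗ (p ⊗ (q ⊕ ⊝ (σ ⊗ r))))) ≡ b ⊗ (a ⊗ ((s ⊗ p) ⊗ q)) ⊕ ⊝ (σ ⊗ (b ⊗ (a ⊗ ((s ⊗ p) ⊗ r))))
  expand-signed = solve-∀ ℚ√5-ring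
  forward : ∀ i → S i ≡ appellTerm M c y e i ⊕ ⊝ (σ ⊗ appellTerm M c x e i)
  forward i = expand σ (ιₙ (M C i)) (c i) (e ^ i) (y ^ (M ∸ i)) (x ^ (M ∸ i))
  backward : ∀ i → sign i ⊗ S i ≡ appellTerm M c y (⊝ e) i ⊕ ⊝ (σ ⊗ appellTerm M c (y ⊕ ⊝ e) (⊝ e) i)
  backward i = begin
    sign i ⊗ S i
      ≡⟨ expand-signed σ (sign i) (ιₙ (M C i)) (c i) (e ^ i) (y ^ (M ∸ i)) (x ^ (M ∸ i)) ⟩
    ιₙ (M C i) ⊗ (c i ⊗ ((sign i ⊗ e ^ i) ⊗ y ^ (M ∸ i))) ⊕ ⊝ (σ ⊗ (ιₙ (M C i) ⊗ (c i ⊗ ((sign i ⊗ e ^ i) ⊗ x ^ (M ∸ i)))))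
      ≡⟨ cong₂ (λ p z → ιₙ (M C i) ⊗ (c i ⊗ (p ⊗ y ^ (M ∸ i))) ⊕ ⊝ (σ ⊗ (ιₙ (M C i) ⊗ (c i ⊗ (p ⊗ z ^ (M ∸ i))))))
           (sym (⊝-^ e i)) (sym y⊖e≡x) ⟩
    appellTerm M c y (⊝ e) i ⊕ ⊝ (σ ⊗ appellTerm M c (y ⊕ ⊝ e) (⊝ e) i) ∎
  collect : ∀ s k t a b p q e → (s ⊗ a ⊕ k ⊗ (t ⊗ (p ⊗ e)) ⊕ ⊝ (s ⊗ a)) ⊕ (b ⊕ ⊝ (s ⊗ (s ⊗ b ⊕ k ⊗ (t ⊗ (q ⊗ ⊝ e)))))
                                ≡ k ⊗ (t ⊗ (e ⊗ (p ⊕ s ⊗ q))) ⊕ (𝟙 ⊕ ⊝ (s ⊗ s)) ⊗ b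
  collect = solve-∀ ℚ√5-ring
  vanish : ∀ a b → a ⊕ (𝟙 ⊕ ⊝ 𝟙) ⊗ b ≡ a
  vanish = solve-∀ ℚ√5-ring

ι-sumℚ : ∀ n (f : ℕ → ℚ) → ι (sumℚ (applyUpTo f n)) ≡ ∑ n (ι ∘ f)
ι-sumℚ zero f = refl
ι-sumℚ (suc n) f = cong (ι (f 0) ⊕_) (ι-sumℚ n (f ∘ suc))

ι-Σ[0…] : ∀ N (t : ℕ → ℚ) → ι (Σ[0… N ] t) ≡ ∑ (suc N) (ι ∘ t)
ι-Σ[0…] N t = trans (cong (ι ∘ sumℚ) (List.map-upTo t (suc N))) (ι-sumℚ (suc N) t)

B : ℕ → ℚ√5
B = ι ∘ bernoulli

bernRev≡applyDownFrom : ∀ m → bernRev m ≡ applyDownFrom bernoulli (suc m)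
bernRev≡applyDownFrom zero = refl
bernRev≡applyDownFrom (suc m) = cong (bernoulli (suc m) ∷_) (bernRev≡applyDownFrom m)

reverse-applyDownFrom : ∀ {A : Set} (f : ℕ → A) n → reverse (applyDownFrom f n) ≡ applyUpTo f n
reverse-applyDownFrom f zero = refl
reverse-applyDownFrom f (suc n) = begin
  reverse (f n ∷ applyDownFrom f n)     ≡⟨ List.unfold-reverse (f n) (applyDownFrom f n) ⟩
  reverse (applyDownFrom f n) ∷ʳ f n    ≡⟨ cong (_∷ʳ f n) (reverse-applyDownFrom f n) ⟩
  applyUpTo f n ∷ʳ f n                  ≡⟨ List.applyUpTo-∷ʳ f n ⟩
  applyUpTo f (suc n)                   ∎

zipWith-applyUpTo : ∀ {A B C : Set} (h : A → B → C) (f : ℕ → A) (g : ℕ → B) n →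
  zipWith h (applyUpTo f n) (applyUpTo g n) ≡ applyUpTo (λ k → h (f k) (g k)) n
zipWith-applyUpTo h f g zero = refl
zipWith-applyUpTo h f g (suc n) = cong (h (f 0) (g 0) ∷_) (zipWith-applyUpTo h (f ∘ suc) (g ∘ suc) n)

∑-C*B≡0 : ∀ m → ∑ (suc (suc m)) (λ k → ιₙ (suc (suc m) C k) ⊗ B k) ≡ 𝟘
∑-C*B≡0 m = begin
  ∑ M f                                       ≡⟨ ∑-last (suc m) f ⟩
  ∑ (suc m) f ⊕ ιₙ (M C suc m) ⊗ B (suc m)    ≡⟨ cong₂ _⊕_ lower-terms (cong (λ c → ιₙ c ⊗ B (suc m)) ([n+1]Cn≡n+1 (suc m))) ⟩
  ι S ⊕ ιₙ M ⊗ ι (- (M⁻¹ * S))                ≡⟨ cong (λ z → ι S ⊕ ιₙ M ⊗ ⊝ z) (ι-* M⁻¹ S) ⟩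
  ι S ⊕ ιₙ M ⊗ ⊝ (ι M⁻¹ ⊗ ι S)                ≡⟨ regroup (ι S) (ιₙ M) (ι M⁻¹) ⟩
  ι S ⊕ ⊝ ((ι M⁻¹ ⊗ ιₙ M) ⊗ ι S)              ≡⟨ cong (λ z → ι S ⊕ ⊝ (z ⊗ ι S)) (ι[1/n]⊗ιₙn≡𝟙 M) ⟩
  ι S ⊕ ⊝ (𝟙 ⊗ ι S)                           ≡⟨ cancel (ι S) ⟩
  𝟘                                           ∎
  where
  M = suc (suc m)
  M⁻¹ = + 1 ℚ./ M
  f : ℕ → ℚ√5
  f k = ιₙ (M C k) ⊗ B k
  -- By the definition of bernRev, bernoulli (suc m) unfolds to − S / (m + 2).
  S = sumℚ (zipWith (λ k b → ⟦ M C k ⟧ * b) (upTo (suc m)) (reverse (bernRev m)))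
  lower-terms : ∑ (suc m) f ≡ ι S
  lower-terms = sym (begin
    ι S                                                                     ≡⟨ cong (λ l → ι (sumℚ (zipWith (λ k b → ⟦ M C k ⟧ * b) (upTo (suc m)) l)))
                                                                                 (trans (cong reverse (bernRev≡applyDownFrom m)) (reverse-applyDownFrom bernoulli (suc m))) ⟩
    ι (sumℚ (zipWith (λ k b → ⟦ M C k ⟧ * b) (upTo (suc m)) (applyUpTo bernoulli (suc m))))
                                                                            ≡⟨ cong (ι ∘ sumℚ) (zipWith-applyUpTo (λ k b → ⟦ M C k ⟧ * b) (λ k → k) bernoulli (suc m)) ⟩
    ι (sumℚ (applyUpTo (λ k → ⟦ M C k ⟧ * bernoulli k) (suc m)))            ≡⟨ ι-sumℚ (suc m) (λ k → ⟦ M C k ⟧ * bernoulli k) ⟩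
    ∑ (suc m) (λ k → ι (⟦ M C k ⟧ * bernoulli k))                            ≡⟨ ∑-cong (suc m) (λ k → ι-* ⟦ M C k ⟧ (bernoulli k)) ⟩
    ∑ (suc m) f                                                             ∎)
  regroup : ∀ s n q → s ⊕ n ⊗ ⊝ (q ⊗ s) ≡ s ⊕ ⊝ ((q ⊗ n) ⊗ s)
  regroup = solve-∀ ℚ√5-ring
  cancel : ∀ s → s ⊕ ⊝ (𝟙 ⊗ s) ≡ 𝟘
  cancel = solve-∀ ℚ√5-ring

bernoulli-recurrence : BinomialRecurrence B 𝟙 𝟙
bernoulli-recurrence zero = refl
bernoulli-recurrence (suc zero) = refl
bernoulli-recurrence (suc (suc r)) = begin
  ∑ (suc M) f                   ≡⟨ ∑-last M f ⟩
  ∑ M f ⊕ ιₙ (M C M) ⊗ B M      ≡⟨ cong₂ (λ a c → a ⊕ ιₙ c ⊗ B M) (∑-C*B≡0 r) (nCn≡1 M) ⟩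
  𝟘 ⊕ 𝟙 ⊗ B M                   ≡⟨ ⊕-comm 𝟘 (𝟙 ⊗ B M) ⟩
  𝟙 ⊗ B M ⊕ 𝟘                   ∎
  where
  M = suc (suc r)
  f : ℕ → ℚ√5
  f k = ιₙ (M C k) ⊗ B k

∑-C*w≡0 : ∀ {w τ} → BinomialRecurrence w 𝟙 τ → ∀ m → ∑ (suc (suc m)) (λ k → ιₙ (suc (suc m) C k) ⊗ w k) ≡ 𝟘
∑-C*w≡0 {w} rec m = ⊕-cancelʳ (𝟙 ⊗ w M) (begin
  ∑ M f ⊕ 𝟙 ⊗ w M          ≡⟨ cong (λ c → ∑ M f ⊕ ιₙ c ⊗ w M) (nCn≡1 M) ⟨
  ∑ M f ⊕ f M              ≡⟨ ∑-last M f ⟨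
  ∑ (suc M) f              ≡⟨ rec M ⟩
  𝟙 ⊗ w M ⊕ 𝟘              ≡⟨ ⊕-comm (𝟙 ⊗ w M) 𝟘 ⟩
  𝟘 ⊕ 𝟙 ⊗ w M              ∎)
  where
  M = suc (suc m)
  f : ℕ → ℚ√5
  f k = ιₙ (M C k) ⊗ w k

-- The top term of ∑-C*w≡0 is (m + 2) w (m + 1), so w (m + 1) is determined by the earlier values.
BinomialRecurrence-unique : ∀ {u v τ} → BinomialRecurrence u 𝟙 τ → BinomialRecurrence v 𝟙 τ → u 0 ≡ v 0 → ∀ r → u r ≡ v r
BinomialRecurrence-unique {u} {v} rec-u rec-v u0≡v0 = <-rec (λ r → u r ≡ v r) step
  where
  split : ∀ {w τ} → BinomialRecurrence w 𝟙 τ → ∀ m →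
    ∑ (suc m) (λ k → ιₙ (suc (suc m) C k) ⊗ w k) ⊕ ιₙ (suc (suc m)) ⊗ w (suc m) ≡ 𝟘
  split {w} rec m = trans (cong (λ c → ∑ (suc m) (λ k → ιₙ (suc (suc m) C k) ⊗ w k) ⊕ ιₙ c ⊗ w (suc m)) (sym ([n+1]Cn≡n+1 (suc m))))
                          (trans (sym (∑-last (suc m) (λ k → ιₙ (suc (suc m) C k) ⊗ w k))) (∑-C*w≡0 rec m))
  step : ∀ r → (∀ {k} → k < r → u k ≡ v k) → u r ≡ v r
  step zero _ = u0≡v0
  step (suc m) ih = ιₙ-cancelˡ (suc (suc m)) (⊕-cancelˡ (∑ (suc m) (λ k → ιₙ (suc (suc m) C k) ⊗ v k)) (begin
    ∑ (suc m) (λ k → ιₙ (suc (suc m) C k) ⊗ v k) ⊕ ιₙ (suc (suc m)) ⊗ u (suc m)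
      ≡⟨ cong (_⊕ ιₙ (suc (suc m)) ⊗ u (suc m)) (∑-cong-< (suc m) (λ k k<1+m → cong (ιₙ (suc (suc m) C k) ⊗_) (ih k<1+m))) ⟨
    ∑ (suc m) (λ k → ιₙ (suc (suc m) C k) ⊗ u k) ⊕ ιₙ (suc (suc m)) ⊗ u (suc m)
      ≡⟨ split rec-u m ⟩
    𝟘
      ≡⟨ split rec-v m ⟨
    ∑ (suc m) (λ k → ιₙ (suc (suc m) C k) ⊗ v k) ⊕ ιₙ (suc (suc m)) ⊗ v (suc m) ∎))

𝟙^ : ∀ n → 𝟙 ^ n ≡ 𝟙
𝟙^ zero = refl
𝟙^ (suc n) = trans (⊗-identityˡ (𝟙 ^ n)) (𝟙^ n)

∑-C≡2^ : ∀ n → ∑ (suc n) (λ k → ιₙ (n C k)) ≡ ιₙ 2 ^ n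
∑-C≡2^ n = sym (trans (binomial 𝟙 𝟙 n) (∑-cong (suc n) (λ k →
  trans (cong₂ (λ a b → ιₙ (n C k) ⊗ (a ⊗ b)) (𝟙^ k) (𝟙^ (n ∸ k))) (⊗-identityʳ (ιₙ (n C k))))))

∑-binomial-transform² : ∀ r (a : ℕ → ℚ√5) →
  ∑ (suc r) (λ k → ιₙ (r C k) ⊗ ∑ (suc k) (λ i → ιₙ (k C i) ⊗ a i)) ≡ ∑ (suc r) (λ i → ιₙ (r C i) ⊗ (ιₙ 2 ^ (r ∸ i) ⊗ a i))
∑-binomial-transform² r a = begin
  ∑ (suc r) F                                                                        ≡⟨ ∑-reverse (suc r) F ⟩
  ∑ (suc r) (λ k → F (r ∸ k))                                                        ≡⟨ ∑-cong-< (suc r) (λ k k<1+r →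
                                                                                          cong (λ c → ιₙ c ⊗ ∑ (suc (r ∸ k)) (λ i → ιₙ ((r ∸ k) C i) ⊗ a i)) (sym (nCk≡nC[n∸k] (ℕₚ.≤-pred k<1+r)))) ⟩
  ∑ (suc r) (λ k → ιₙ (r C k) ⊗ ∑ (suc (r ∸ k)) (λ i → ιₙ ((r ∸ k) C i) ⊗ a i))      ≡⟨ ∑-binomial-swap r (λ _ i → a i) ⟩
  ∑ (suc r) (λ i → ιₙ (r C i) ⊗ ∑ (suc (r ∸ i)) (λ k → ιₙ ((r ∸ i) C k) ⊗ a i))      ≡⟨ ∑-cong (suc r) (λ i → cong (ιₙ (r C i) ⊗_)
                                                                                          (trans (sym (∑-⊗ʳ (suc (r ∸ i)) (a i) (λ k → ιₙ ((r ∸ i) C k))))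
                                                                                                 (cong (_⊗ a i) (∑-C≡2^ (r ∸ i))))) ⟩
  ∑ (suc r) (λ i → ιₙ (r C i) ⊗ (ιₙ 2 ^ (r ∸ i) ⊗ a i))                              ∎
  where
  F : ℕ → ℚ√5
  F k = ιₙ (r C k) ⊗ ∑ (suc k) (λ i → ιₙ (k C i) ⊗ a i)

-- 2^r B_r(1/2) = (2 − 2^r) B_r: the sequence ½ (2^r B_r + 2^r B_r(1/2)) satisfies the Bernoulli recurrence.
bernoulli-at-half : ∀ r → ∑ (suc r) (λ i → ιₙ (r C i) ⊗ (ιₙ 2 ^ i ⊗ B i)) ≡ ιₙ 2 ⊗ B r ⊕ ⊝ (ιₙ 2 ^ r ⊗ B r)
bernoulli-at-half r = begin
  A r                                   ≡⟨ solve-A (A r) (ιₙ 2 ^ r ⊗ B r) ⟩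
  ιₙ 2 ⊗ γ r ⊕ ⊝ (ιₙ 2 ^ r ⊗ B r)       ≡⟨ cong (λ z → ιₙ 2 ⊗ z ⊕ ⊝ (ιₙ 2 ^ r ⊗ B r)) (BinomialRecurrence-unique {γ} {B} γ-recurrence bernoulli-recurrence refl r) ⟩
  ιₙ 2 ⊗ B r ⊕ ⊝ (ιₙ 2 ^ r ⊗ B r)       ∎
  where
  A γ : ℕ → ℚ√5
  A r = ∑ (suc r) (λ i → ιₙ (r C i) ⊗ (ιₙ 2 ^ i ⊗ B i))
  γ r = half ⊗ (ιₙ 2 ^ r ⊗ B r ⊕ A r)
  solve-A : ∀ a p → a ≡ ιₙ 2 ⊗ (half ⊗ (p ⊕ a)) ⊕ ⊝ p
  solve-A = solve-∀ ℚ√5-ring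
  half-δ₁ : ∀ r → half ⊗ (ιₙ 2 ^ r ⊗ δ₁ 𝟙 r) ≡ δ₁ 𝟙 r
  half-δ₁ zero = refl
  half-δ₁ (suc zero) = refl
  half-δ₁ (suc (suc r)) = trans (cong (half ⊗_) (⊗-zeroʳ _)) (⊗-zeroʳ half)
  ∑-C*A : ∀ r → ∑ (suc r) (λ k → ιₙ (r C k) ⊗ A k) ≡ ιₙ 2 ^ r ⊗ (𝟙 ⊗ B r ⊕ δ₁ 𝟙 r)
  ∑-C*A r = begin
    ∑ (suc r) (λ k → ιₙ (r C k) ⊗ A k)                              ≡⟨ ∑-binomial-transform² r (λ i → ιₙ 2 ^ i ⊗ B i) ⟩
    ∑ (suc r) (λ i → ιₙ (r C i) ⊗ (ιₙ 2 ^ (r ∸ i) ⊗ (ιₙ 2 ^ i ⊗ B i))) ≡⟨ ∑-cong-< (suc r) (λ i i<1+r → powers i (ℕₚ.≤-pred i<1+r)) ⟩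
    ∑ (suc r) (λ i → ιₙ 2 ^ r ⊗ (ιₙ (r C i) ⊗ B i))                  ≡⟨ ∑-⊗ˡ (suc r) (ιₙ 2 ^ r) (λ i → ιₙ (r C i) ⊗ B i) ⟨
    ιₙ 2 ^ r ⊗ ∑ (suc r) (λ i → ιₙ (r C i) ⊗ B i)                    ≡⟨ cong (ιₙ 2 ^ r ⊗_) (bernoulli-recurrence r) ⟩
    ιₙ 2 ^ r ⊗ (𝟙 ⊗ B r ⊕ δ₁ 𝟙 r)                                    ∎
    where
    regroup : ∀ c p q b → c ⊗ (q ⊗ (p ⊗ b)) ≡ (p ⊗ q) ⊗ (c ⊗ b)
    regroup = solve-∀ ℚ√5-ring
    powers : ∀ i → i ≤ r → ιₙ (r C i) ⊗ (ιₙ 2 ^ (r ∸ i) ⊗ (ιₙ 2 ^ i ⊗ B i)) ≡ ιₙ 2 ^ r ⊗ (ιₙ (r C i) ⊗ B i)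
    powers i i≤r = trans (regroup (ιₙ (r C i)) (ιₙ 2 ^ i) (ιₙ 2 ^ (r ∸ i)) (B i))
      (cong (_⊗ (ιₙ (r C i) ⊗ B i)) (trans (sym (^-+ (ιₙ 2) i (r ∸ i))) (cong (ιₙ 2 ^_) (ℕₚ.m+[n∸m]≡n i≤r))))
  γ-recurrence : BinomialRecurrence γ 𝟙 𝟙
  γ-recurrence r = begin
    ∑ (suc r) (λ k → ιₙ (r C k) ⊗ γ k)                                  ≡⟨ ∑-cong (suc r) (λ k → spread (ιₙ (r C k)) (ιₙ 2 ^ k ⊗ B k) (A k)) ⟩
    ∑ (suc r) (λ k → half ⊗ (ιₙ (r C k) ⊗ (ιₙ 2 ^ k ⊗ B k) ⊕ ιₙ (r C k) ⊗ A k))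
                                                                        ≡⟨ ∑-⊗ˡ (suc r) half (λ k → P k ⊕ Q k) ⟨
    half ⊗ ∑ (suc r) (λ k → ιₙ (r C k) ⊗ (ιₙ 2 ^ k ⊗ B k) ⊕ ιₙ (r C k) ⊗ A k)
                                                                        ≡⟨ cong (half ⊗_) (∑-⊕ (suc r) P Q) ⟩
    half ⊗ (A r ⊕ ∑ (suc r) (λ k → ιₙ (r C k) ⊗ A k))                   ≡⟨ cong (λ z → half ⊗ (A r ⊕ z)) (∑-C*A r) ⟩
    half ⊗ (A r ⊕ ιₙ 2 ^ r ⊗ (𝟙 ⊗ B r ⊕ δ₁ 𝟙 r))                        ≡⟨ regroup (A r) (ιₙ 2 ^ r) (B r) (δ₁ 𝟙 r) ⟩
    𝟙 ⊗ γ r ⊕ half ⊗ (ιₙ 2 ^ r ⊗ δ₁ 𝟙 r)                                ≡⟨ cong (𝟙 ⊗ γ r ⊕_) (half-δ₁ r) ⟩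
    𝟙 ⊗ γ r ⊕ δ₁ 𝟙 r                                                    ∎
    where
    P Q : ℕ → ℚ√5
    P k = ιₙ (r C k) ⊗ (ιₙ 2 ^ k ⊗ B k)
    Q k = ιₙ (r C k) ⊗ A k
    spread : ∀ c p a → c ⊗ (half ⊗ (p ⊕ a)) ≡ half ⊗ (c ⊗ p ⊕ c ⊗ a)
    spread = solve-∀ ℚ√5-ring
    regroup : ∀ a p b d → half ⊗ (a ⊕ p ⊗ (𝟙 ⊗ b ⊕ d)) ≡ 𝟙 ⊗ (half ⊗ (p ⊗ b ⊕ a)) ⊕ half ⊗ (p ⊗ d)
    regroup = solve-∀ ℚ√5-ring

genocchi : ℕ → ℚ√5
genocchi k = ιₙ 2 ⊗ ((𝟙 ⊕ ⊝ ιₙ 2 ^ k) ⊗ B k)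

genocchi-recurrence : BinomialRecurrence genocchi (⊝ 𝟙) (ιₙ 2)
genocchi-recurrence r = begin
  ∑ (suc r) (λ k → ιₙ (r C k) ⊗ genocchi k)
    ≡⟨ ∑-cong (suc r) (λ k → spread (ιₙ (r C k)) (ιₙ 2 ^ k) (B k)) ⟩
  ∑ (suc r) (λ k → ιₙ 2 ⊗ (ιₙ (r C k) ⊗ B k) ⊕ ⊝ (ιₙ 2 ⊗ (ιₙ (r C k) ⊗ (ιₙ 2 ^ k ⊗ B k))))
    ≡⟨ ∑-⊖ (suc r) (λ k → ιₙ 2 ⊗ P k) (λ k → ιₙ 2 ⊗ Q k) ⟩
  ∑ (suc r) (λ k → ιₙ 2 ⊗ (ιₙ (r C k) ⊗ B k)) ⊕ ⊝ ∑ (suc r) (λ k → ιₙ 2 ⊗ (ιₙ (r C k) ⊗ (ιₙ 2 ^ k ⊗ B k)))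
    ≡⟨ cong₂ (λ a b → a ⊕ ⊝ b) (trans (sym (∑-⊗ˡ (suc r) (ιₙ 2) P)) (cong (ιₙ 2 ⊗_) (bernoulli-recurrence r)))
                                (trans (sym (∑-⊗ˡ (suc r) (ιₙ 2) Q)) (cong (ιₙ 2 ⊗_) (bernoulli-at-half r))) ⟩
  ιₙ 2 ⊗ (𝟙 ⊗ B r ⊕ δ₁ 𝟙 r) ⊕ ⊝ (ιₙ 2 ⊗ (ιₙ 2 ⊗ B r ⊕ ⊝ (ιₙ 2 ^ r ⊗ B r)))
    ≡⟨ regroup (B r) (δ₁ 𝟙 r) (ιₙ 2 ^ r) ⟩
  ⊝ 𝟙 ⊗ genocchi r ⊕ ιₙ 2 ⊗ δ₁ 𝟙 r
    ≡⟨ cong (⊝ 𝟙 ⊗ genocchi r ⊕_) (two-δ₁ r) ⟩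
  ⊝ 𝟙 ⊗ genocchi r ⊕ δ₁ (ιₙ 2) r
    ∎
  where
  P Q : ℕ → ℚ√5
  P k = ιₙ (r C k) ⊗ B k
  Q k = ιₙ (r C k) ⊗ (ιₙ 2 ^ k ⊗ B k)
  spread : ∀ c p b → c ⊗ (ιₙ 2 ⊗ ((𝟙 ⊕ ⊝ p) ⊗ b)) ≡ ιₙ 2 ⊗ (c ⊗ b) ⊕ ⊝ (ιₙ 2 ⊗ (c ⊗ (p ⊗ b)))
  spread = solve-∀ ℚ√5-ring
  regroup : ∀ b d p → ιₙ 2 ⊗ (𝟙 ⊗ b ⊕ d) ⊕ ⊝ (ιₙ 2 ⊗ (ιₙ 2 ⊗ b ⊕ ⊝ (p ⊗ b))) ≡ ⊝ 𝟙 ⊗ (ιₙ 2 ⊗ ((𝟙 ⊕ ⊝ p) ⊗ b)) ⊕ ιₙ 2 ⊗ d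
  regroup = solve-∀ ℚ√5-ring
  two-δ₁ : ∀ r → ιₙ 2 ⊗ δ₁ 𝟙 r ≡ δ₁ (ιₙ 2) r
  two-δ₁ zero = refl
  two-δ₁ (suc zero) = refl
  two-δ₁ (suc (suc r)) = refl

φ ψ : ℚ√5
φ = half ⊗ (𝟙 ⊕ √5)
ψ = half ⊗ (𝟙 ⊕ ⊝ √5)

binet : ∀ r → r ⊗ r ≡ ιₙ 5 → ∀ n → (half ⊗ (𝟙 ⊕ r)) ^ n ≡ half ⊗ (ιₙ (lucas n) ⊕ ιₙ (fib n) ⊗ r)
binet r r²≡5 zero = base₀ r
  where
  base₀ : ∀ r → 𝟙 ≡ half ⊗ (ιₙ 2 ⊕ ιₙ 0 ⊗ r)
  base₀ = solve-∀ ℚ√5-ring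
binet r r²≡5 (suc zero) = base₁ r
  where
  base₁ : ∀ r → half ⊗ (𝟙 ⊕ r) ⊗ 𝟙 ≡ half ⊗ (ιₙ 1 ⊕ ιₙ 1 ⊗ r)
  base₁ = solve-∀ ℚ√5-ring
binet r r²≡5 (suc (suc n)) = begin
  x ⊗ (x ⊗ x ^ n)                         ≡⟨ ⊗-assoc x x (x ^ n) ⟨
  (x ⊗ x) ⊗ x ^ n                         ≡⟨ cong (_⊗ x ^ n) x²≡x+1 ⟩
  (x ⊕ 𝟙) ⊗ x ^ n                         ≡⟨ ⊗-distribʳ-⊕ (x ^ n) x 𝟙 ⟩
  x ^ suc n ⊕ 𝟙 ⊗ x ^ n                   ≡⟨ cong₂ (λ a b → a ⊕ 𝟙 ⊗ b) (binet r r²≡5 (suc n)) (binet r r²≡5 n) ⟩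
  half ⊗ (ιₙ (lucas (suc n)) ⊕ ιₙ (fib (suc n)) ⊗ r) ⊕ 𝟙 ⊗ (half ⊗ (ιₙ (lucas n) ⊕ ιₙ (fib n) ⊗ r))
                                          ≡⟨ add-halves (ιₙ (lucas (suc n))) (ιₙ (lucas n)) (ιₙ (fib (suc n))) (ιₙ (fib n)) r ⟩
  half ⊗ ((ιₙ (lucas (suc n)) ⊕ ιₙ (lucas n)) ⊕ (ιₙ (fib (suc n)) ⊕ ιₙ (fib n)) ⊗ r)
                                          ≡⟨ cong₂ (λ a b → half ⊗ (a ⊕ b ⊗ r)) (ιₙ-+ (lucas (suc n)) (lucas n)) (ιₙ-+ (fib (suc n)) (fib n)) ⟨
  half ⊗ (ιₙ (lucas (suc (suc n))) ⊕ ιₙ (fib (suc (suc n))) ⊗ r) ∎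
  where
  x = half ⊗ (𝟙 ⊕ r)
  expand-square : ∀ r → half ⊗ (𝟙 ⊕ r) ⊗ (half ⊗ (𝟙 ⊕ r)) ≡ half ⊗ half ⊗ (𝟙 ⊕ ιₙ 2 ⊗ r ⊕ r ⊗ r)
  expand-square = solve-∀ ℚ√5-ring
  finish : ∀ r → half ⊗ half ⊗ (𝟙 ⊕ ιₙ 2 ⊗ r ⊕ ιₙ 5) ≡ half ⊗ (𝟙 ⊕ r) ⊕ 𝟙
  finish = solve-∀ ℚ√5-ring
  add-halves : ∀ a b c d r → half ⊗ (a ⊕ c ⊗ r) ⊕ 𝟙 ⊗ (half ⊗ (b ⊕ d ⊗ r)) ≡ half ⊗ ((a ⊕ b) ⊕ (c ⊕ d) ⊗ r)
  add-halves = solve-∀ ℚ√5-ring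
  x²≡x+1 : x ⊗ x ≡ x ⊕ 𝟙
  x²≡x+1 = begin
    x ⊗ x                                   ≡⟨ expand-square r ⟩
    half ⊗ half ⊗ (𝟙 ⊕ ιₙ 2 ⊗ r ⊕ r ⊗ r)    ≡⟨ cong (λ s → half ⊗ half ⊗ (𝟙 ⊕ ιₙ 2 ⊗ r ⊕ s)) r²≡5 ⟩
    half ⊗ half ⊗ (𝟙 ⊕ ιₙ 2 ⊗ r ⊕ ιₙ 5)     ≡⟨ finish r ⟩
    x ⊕ 𝟙                                   ∎

module Binet (j : ℕ) where

  F L Q : ℚ
  F = ⟦ fib j ⟧
  L = ⟦ lucas j ⟧
  Q = ⟦ 5 ⟧ * (F ^ℚ 2)

  α β d : ℚ√5
  α = φ ^ j
  β = ψ ^ j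
  d = ι F ⊗ √5

  α^ : ∀ r → α ^ r ≡ half ⊗ (ιₙ (lucas (j ℕ.* r)) ⊕ ιₙ (fib (j ℕ.* r)) ⊗ √5)
  α^ r = trans (sym (^-* φ j r)) (binet √5 refl (j ℕ.* r))

  β^ : ∀ r → β ^ r ≡ half ⊗ (ιₙ (lucas (j ℕ.* r)) ⊕ ιₙ (fib (j ℕ.* r)) ⊗ ⊝ √5)
  β^ r = trans (sym (^-* ψ j r)) (binet (⊝ √5) refl (j ℕ.* r))

  α≡β⊕d : α ≡ β ⊕ d
  α≡β⊕d = trans (binet √5 refl j) (trans (shift (ι L) (ι F)) (cong (_⊕ d) (sym (binet (⊝ √5) refl j))))
    where
    shift : ∀ l f → half ⊗ (l ⊕ f ⊗ √5) ≡ half ⊗ (l ⊕ f ⊗ ⊝ √5) ⊕ f ⊗ √5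
    shift = solve-∀ ℚ√5-ring

  α≡½d⊕½L : α ≡ half ⊗ d ⊕ half ⊗ ι L
  α≡½d⊕½L = trans (binet √5 refl j) (split (ι L) (ι F))
    where
    split : ∀ l f → half ⊗ (l ⊕ f ⊗ √5) ≡ half ⊗ (f ⊗ √5) ⊕ half ⊗ l
    split = solve-∀ ℚ√5-ring

  β≡⊝½d⊕½L : β ≡ ⊝ (half ⊗ d) ⊕ half ⊗ ι L
  β≡⊝½d⊕½L = trans (binet (⊝ √5) refl j) (split (ι L) (ι F))
    where
    split : ∀ l f → half ⊗ (l ⊕ f ⊗ ⊝ √5) ≡ ⊝ (half ⊗ (f ⊗ √5)) ⊕ half ⊗ l
    split = solve-∀ ℚ√5-ring

  α^⊕β^ : ∀ r → α ^ r ⊕ β ^ r ≡ ιₙ (lucas (j ℕ.* r))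
  α^⊕β^ r = trans (cong₂ _⊕_ (α^ r) (β^ r)) (add (ιₙ (lucas (j ℕ.* r))) (ιₙ (fib (j ℕ.* r))))
    where
    add : ∀ l f → half ⊗ (l ⊕ f ⊗ √5) ⊕ half ⊗ (l ⊕ f ⊗ ⊝ √5) ≡ l
    add = solve-∀ ℚ√5-ring

  α^⊖β^ : ∀ r → α ^ r ⊕ ⊝ β ^ r ≡ ιₙ (fib (j ℕ.* r)) ⊗ √5
  α^⊖β^ r = trans (cong₂ (λ a b → a ⊕ ⊝ b) (α^ r) (β^ r)) (subtract (ιₙ (lucas (j ℕ.* r))) (ιₙ (fib (j ℕ.* r))))
    where
    subtract : ∀ l f → half ⊗ (l ⊕ f ⊗ √5) ⊕ ⊝ (half ⊗ (l ⊕ f ⊗ ⊝ √5)) ≡ f ⊗ √5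
    subtract = solve-∀ ℚ√5-ring

  d⊗d≡ιQ : d ⊗ d ≡ ι Q
  d⊗d≡ιQ = begin
    ι F ⊗ √5 ⊗ (ι F ⊗ √5)       ≡⟨ square (ι F) ⟩
    ιₙ 5 ⊗ (ι F ⊗ (ι F ⊗ 𝟙))    ≡⟨ cong (ιₙ 5 ⊗_) (ι-^ F 2) ⟨
    ιₙ 5 ⊗ ι (F ^ℚ 2)           ≡⟨ ι-* ⟦ 5 ⟧ (F ^ℚ 2) ⟨
    ι Q                         ∎
    where
    square : ∀ f → f ⊗ √5 ⊗ (f ⊗ √5) ≡ ιₙ 5 ⊗ (f ⊗ (f ⊗ 𝟙))
    square = solve-∀ ℚ√5-ring

appell-shift-even : ∀ {c τ} → BinomialRecurrence c 𝟙 τ → ∀ n x e →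
  ιₙ 2 ⊗ ∑ (suc (n / 2)) (λ k → appellShiftTerm (suc n) c 𝟙 x e (2 ℕ.* k)) ≡ ιₙ (suc n) ⊗ (τ ⊗ (e ⊗ (x ^ n ⊕ 𝟙 ⊗ (x ⊕ e) ^ n)))
appell-shift-even {c} {τ} rec n x e = begin
  ιₙ 2 ⊗ ∑ (suc (n / 2)) (λ k → S (2 ℕ.* k))    ≡⟨ ∑-even-part n S ⟨
  ∑ (suc n) G                                  ≡⟨ ⊕-identityʳ (∑ (suc n) G) ⟨
  ∑ (suc n) G ⊕ 𝟘                              ≡⟨ cong (∑ (suc n) G ⊕_) top-vanishes ⟨
  ∑ (suc n) G ⊕ G (suc n)                      ≡⟨ ∑-last (suc n) G ⟨
  ∑ (suc (suc n)) G                            ≡⟨ appell-shift-alternating rec refl n x e ⟩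
  ιₙ (suc n) ⊗ (τ ⊗ (e ⊗ (x ^ n ⊕ 𝟙 ⊗ (x ⊕ e) ^ n))) ∎
  where
  S G : ℕ → ℚ√5
  S = appellShiftTerm (suc n) c 𝟙 x e
  G i = S i ⊕ sign i ⊗ S i
  vanish : ∀ a b p s → a ⊗ (b ⊗ (p ⊗ (𝟙 ⊕ ⊝ (𝟙 ⊗ 𝟙)))) ⊕ s ⊗ (a ⊗ (b ⊗ (p ⊗ (𝟙 ⊕ ⊝ (𝟙 ⊗ 𝟙))))) ≡ 𝟘
  vanish = solve-∀ ℚ√5-ring
  top : ℕ → ℚ√5
  top r = ιₙ (suc n C suc n) ⊗ (c (suc n) ⊗ (e ^ suc n ⊗ ((x ⊕ e) ^ r ⊕ ⊝ (𝟙 ⊗ x ^ r))))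
  top-vanishes : G (suc n) ≡ 𝟘
  top-vanishes = trans (cong (λ r → top r ⊕ sign (suc n) ⊗ top r) (ℕₚ.n∸n≡0 n))
                       (vanish (ιₙ (suc n C suc n)) (c (suc n)) (e ^ suc n) (sign (suc n)))

appell-shift-even-from-2 : ∀ {c σ τ} → BinomialRecurrence c σ τ → σ ⊗ σ ≡ 𝟙 → c 0 ≡ 𝟘 → ∀ n x e →
  ιₙ 2 ⊗ ∑ (suc (n / 2)) (λ k → appellShiftTerm (suc (suc n)) c σ x e (2 ℕ.+ 2 ℕ.* k))
  ≡ ιₙ (suc (suc n)) ⊗ (τ ⊗ (e ⊗ (x ^ suc n ⊕ σ ⊗ (x ⊕ e) ^ suc n)))
appell-shift-even-from-2 {c} {σ} {τ} rec σ²≡𝟙 c0≡𝟘 n x e = begin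
  ιₙ 2 ⊗ ∑ (suc (n / 2)) (λ k → S (2 ℕ.+ 2 ℕ.* k))           ≡⟨ cong (ιₙ 2 ⊗_) (⊕-identityˡ _) ⟨
  ιₙ 2 ⊗ (𝟘 ⊕ ∑ (suc (n / 2)) (λ k → S (2 ℕ.+ 2 ℕ.* k)))     ≡⟨ cong₂ (λ a b → ιₙ 2 ⊗ (a ⊕ b)) bottom-vanishes
                                                                   (∑-cong (suc (n / 2)) (λ k → cong S (sym (ℕₚ.*-suc 2 k)))) ⟩
  ιₙ 2 ⊗ ∑ (suc (suc (n / 2))) (λ k → S (2 ℕ.* k))            ≡⟨ cong (λ q → ιₙ 2 ⊗ ∑ (suc q) (λ k → S (2 ℕ.* k))) (m/n≡1+[m∸n]/n {2 ℕ.+ n} {2} (s≤s (s≤s z≤n))) ⟨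
  ιₙ 2 ⊗ ∑ (suc ((2 ℕ.+ n) / 2)) (λ k → S (2 ℕ.* k))          ≡⟨ ∑-even-part (suc (suc n)) S ⟨
  ∑ (suc (suc (suc n))) (λ i → S i ⊕ sign i ⊗ S i)           ≡⟨ appell-shift-alternating rec σ²≡𝟙 (suc n) x e ⟩
  ιₙ (suc (suc n)) ⊗ (τ ⊗ (e ⊗ (x ^ suc n ⊕ σ ⊗ (x ⊕ e) ^ suc n))) ∎
  where
  S : ℕ → ℚ√5
  S = appellShiftTerm (suc (suc n)) c σ x e
  bottom-vanishes : 𝟘 ≡ S 0
  bottom-vanishes = sym (trans (cong (λ z → ιₙ 1 ⊗ (z ⊗ (𝟙 ⊗ ((x ⊕ e) ^ suc (suc n) ⊕ ⊝ (σ ⊗ x ^ suc (suc n)))))) c0≡𝟘)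
                               (trans (cong (ιₙ 1 ⊗_) (⊗-zeroˡ _)) (⊗-zeroʳ (ιₙ 1))))

k<1+n/2⇒2k≤n : ∀ n k → k < suc (n / 2) → 2 ℕ.* k ≤ n
k<1+n/2⇒2k≤n n k k<1+n/2 = ℕₚ.≤-trans (ℕₚ.*-monoʳ-≤ 2 (ℕₚ.≤-pred k<1+n/2)) (subst (_≤ n) (ℕₚ.*-comm (n / 2) 2) (m/n*n≤m n 2))

scaled-powers : ∀ s a b k u → ((s ⊗ a) ⊗ (s ⊗ a)) ^ k ⊗ (s ⊗ b) ^ u ≡ s ^ (2 ℕ.* k ℕ.+ u) ⊗ ((a ⊗ a) ^ k ⊗ b ^ u)
scaled-powers s a b k u = begin
  ((s ⊗ a) ⊗ (s ⊗ a)) ^ k ⊗ (s ⊗ b) ^ u              ≡⟨ cong (λ z → z ^ k ⊗ (s ⊗ b) ^ u) (interchange s a s a) ⟩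
  ((s ⊗ s) ⊗ (a ⊗ a)) ^ k ⊗ (s ⊗ b) ^ u              ≡⟨ cong₂ _⊗_ (⊗-^ (s ⊗ s) (a ⊗ a) k) (⊗-^ s b u) ⟩
  ((s ⊗ s) ^ k ⊗ (a ⊗ a) ^ k) ⊗ (s ^ u ⊗ b ^ u)      ≡⟨ interchange ((s ⊗ s) ^ k) ((a ⊗ a) ^ k) (s ^ u) (b ^ u) ⟩
  ((s ⊗ s) ^ k ⊗ s ^ u) ⊗ ((a ⊗ a) ^ k ⊗ b ^ u)      ≡⟨ cong (λ z → (z ⊗ s ^ u) ⊗ ((a ⊗ a) ^ k ⊗ b ^ u)) (^-2* s k) ⟨
  (s ^ (2 ℕ.* k) ⊗ s ^ u) ⊗ ((a ⊗ a) ^ k ⊗ b ^ u)    ≡⟨ cong (_⊗ ((a ⊗ a) ^ k ⊗ b ^ u)) (^-+ s (2 ℕ.* k) u) ⟨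
  s ^ (2 ℕ.* k ℕ.+ u) ⊗ ((a ⊗ a) ^ k ⊗ b ^ u)        ∎
  where
  interchange : ∀ a b c d → (a ⊗ b) ⊗ (c ⊗ d) ≡ (a ⊗ c) ⊗ (b ⊗ d)
  interchange = solve-∀ ℚ√5-ring

ιₙ-C-absorb : ∀ n i p → i ≤ n → (ιₙ (suc n) ⊗ ιₙ (n C i)) ⊗ ι ((+ p) ℚ./ suc (n ∸ i)) ≡ ιₙ (suc n C i) ⊗ ιₙ p
ιₙ-C-absorb n i p i≤n = begin
  (ιₙ (suc n) ⊗ ιₙ (n C i)) ⊗ ι D                  ≡⟨ cong (_⊗ ι D) (trans (⊗-comm (ιₙ (suc n)) (ιₙ (n C i))) (sym (ιₙ-* (n C i) (suc n)))) ⟩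
  ιₙ ((n C i) ℕ.* suc n) ⊗ ι D                     ≡⟨ cong (λ z → ιₙ z ⊗ ι D) ([n+1]Ck*[n+1∸k]≡nCk*[n+1] n i i≤n) ⟨
  ιₙ ((suc n C i) ℕ.* suc (n ∸ i)) ⊗ ι D           ≡⟨ cong (_⊗ ι D) (ιₙ-* (suc n C i) (suc (n ∸ i))) ⟩
  (ιₙ (suc n C i) ⊗ ιₙ (suc (n ∸ i))) ⊗ ι D        ≡⟨ ⊗-assoc (ιₙ (suc n C i)) (ιₙ (suc (n ∸ i))) (ι D) ⟩
  ιₙ (suc n C i) ⊗ (ιₙ (suc (n ∸ i)) ⊗ ι D)        ≡⟨ cong (ιₙ (suc n C i) ⊗_) (trans (⊗-comm (ιₙ (suc (n ∸ i))) (ι D))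
                                                        (trans (sym (ι-* D ⟦ suc (n ∸ i) ⟧)) (cong ι (/-*-cancel p (suc (n ∸ i)))))) ⟩
  ιₙ (suc n C i) ⊗ ιₙ p                            ∎
  where D = (+ p) ℚ./ suc (n ∸ i)

module _ (n j : ℕ) where
  open Binet j

  coefficient₁ bernoulliPart₁ lucasPart₁ : ℕ → ℚ
  coefficient₁ k = ⟦ n C (2 ℕ.* k) ⟧ * Q ^ℚ k
  bernoulliPart₁ k = ((+ fib (j ℕ.* suc (n ∸ 2 ℕ.* k))) ℚ./ suc (n ∸ 2 ℕ.* k)) * bernoulli (2 ℕ.* k)
  lucasPart₁ k = F * L ^ℚ (n ∸ 2 ℕ.* k) * ½ ^ℚ n

  lucas-power-sum :
    ιₙ 2 ⊗ ∑ (suc (n / 2)) (λ k → ι (coefficient₁ k * lucasPart₁ k))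
    ≡ ι F ⊗ ιₙ (lucas (j ℕ.* n))
  lucas-power-sum = begin
    ιₙ 2 ⊗ ∑ (suc (n / 2)) (λ k → ι (coefficient₁ k * lucasPart₁ k))
                                                  ≡⟨ cong (ιₙ 2 ⊗_) (∑-cong-< (suc (n / 2)) (λ k k<1+n/2 → term k (k<1+n/2⇒2k≤n n k k<1+n/2))) ⟩
    ιₙ 2 ⊗ ∑ (suc (n / 2)) (λ k → ι F ⊗ T k)     ≡⟨ cong (ιₙ 2 ⊗_) (∑-⊗ˡ (suc (n / 2)) (ι F) T) ⟨
    ιₙ 2 ⊗ (ι F ⊗ ∑ (suc (n / 2)) T)              ≡⟨ swap-front (ιₙ 2) (ι F) (∑ (suc (n / 2)) T) ⟩
    ι F ⊗ (ιₙ 2 ⊗ ∑ (suc (n / 2)) T)              ≡⟨ cong (ι F ⊗_) (binomial-even h X n) ⟨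
    ι F ⊗ ((h ⊕ X) ^ n ⊕ (⊝ h ⊕ X) ^ n)          ≡⟨ cong₂ (λ a b → ι F ⊗ (a ^ n ⊕ b ^ n)) α≡½d⊕½L β≡⊝½d⊕½L ⟨
    ι F ⊗ (α ^ n ⊕ β ^ n)                        ≡⟨ cong (ι F ⊗_) (α^⊕β^ n) ⟩
    ι F ⊗ ιₙ (lucas (j ℕ.* n))                   ∎
    where
    h X : ℚ√5
    h = half ⊗ d
    X = half ⊗ ι L
    T : ℕ → ℚ√5
    T k = ιₙ (n C (2 ℕ.* k)) ⊗ ((h ⊗ h) ^ k ⊗ X ^ (n ∸ 2 ℕ.* k))
    swap-front : ∀ a b c → a ⊗ (b ⊗ c) ≡ b ⊗ (a ⊗ c)
    swap-front = solve-∀ ℚ√5-ring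
    regroup : ∀ c q f l p → (c ⊗ q) ⊗ ((f ⊗ l) ⊗ p) ≡ f ⊗ (c ⊗ (p ⊗ (q ⊗ l)))
    regroup = solve-∀ ℚ√5-ring
    term : ∀ k → 2 ℕ.* k ≤ n → ι (coefficient₁ k * lucasPart₁ k) ≡ ι F ⊗ T k
    term k 2k≤n = begin
      ι (⟦ n C (2 ℕ.* k) ⟧ * Q ^ℚ k * (F * L ^ℚ u * ½ ^ℚ n))
        ≡⟨ ι-* (⟦ n C (2 ℕ.* k) ⟧ * Q ^ℚ k) (F * L ^ℚ u * ½ ^ℚ n) ⟩
      ι (⟦ n C (2 ℕ.* k) ⟧ * Q ^ℚ k) ⊗ ι (F * L ^ℚ u * ½ ^ℚ n)
        ≡⟨ cong₂ _⊗_ (trans (ι-* ⟦ n C (2 ℕ.* k) ⟧ (Q ^ℚ k)) (cong (ιₙ (n C (2 ℕ.* k)) ⊗_) (ι-^ Q k)))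
                     (trans (ι-* (F * L ^ℚ u) (½ ^ℚ n)) (cong₂ _⊗_ (trans (ι-* F (L ^ℚ u)) (cong (ι F ⊗_) (ι-^ L u))) (ι-^ ½ n))) ⟩
      (ιₙ (n C (2 ℕ.* k)) ⊗ ι Q ^ k) ⊗ ((ι F ⊗ ι L ^ u) ⊗ half ^ n)
        ≡⟨ regroup (ιₙ (n C (2 ℕ.* k))) (ι Q ^ k) (ι F) (ι L ^ u) (half ^ n) ⟩
      ι F ⊗ (ιₙ (n C (2 ℕ.* k)) ⊗ (half ^ n ⊗ (ι Q ^ k ⊗ ι L ^ u)))
        ≡⟨ cong (λ z → ι F ⊗ (ιₙ (n C (2 ℕ.* k)) ⊗ (half ^ z ⊗ (ι Q ^ k ⊗ ι L ^ u)))) (ℕₚ.m+[n∸m]≡n 2k≤n) ⟨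
      ι F ⊗ (ιₙ (n C (2 ℕ.* k)) ⊗ (half ^ (2 ℕ.* k ℕ.+ u) ⊗ (ι Q ^ k ⊗ ι L ^ u)))
        ≡⟨ cong (λ z → ι F ⊗ (ιₙ (n C (2 ℕ.* k)) ⊗ (half ^ (2 ℕ.* k ℕ.+ u) ⊗ (z ^ k ⊗ ι L ^ u)))) d⊗d≡ιQ ⟨
      ι F ⊗ (ιₙ (n C (2 ℕ.* k)) ⊗ (half ^ (2 ℕ.* k ℕ.+ u) ⊗ ((d ⊗ d) ^ k ⊗ ι L ^ u)))
        ≡⟨ cong (λ z → ι F ⊗ (ιₙ (n C (2 ℕ.* k)) ⊗ z)) (scaled-powers half d (ι L) k u) ⟨
      ι F ⊗ T k ∎
      where u = n ∸ 2 ℕ.* k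

  bernoulli-fibonacci-sum :
    ιₙ 2 ⊗ ∑ (suc (n / 2)) (λ k → ι (coefficient₁ k * bernoulliPart₁ k)) ≡ ι F ⊗ ιₙ (lucas (j ℕ.* n))
  bernoulli-fibonacci-sum = ιₙ-cancelˡ (suc n) (√5-cancelˡ (begin
    √5 ⊗ (ιₙ (suc n) ⊗ (ιₙ 2 ⊗ ∑ (suc (n / 2)) t))          ≡⟨ rotate √5 (ιₙ (suc n)) (ιₙ 2) (∑ (suc (n / 2)) t) ⟩
    ιₙ 2 ⊗ (√5 ⊗ (ιₙ (suc n) ⊗ ∑ (suc (n / 2)) t))          ≡⟨ cong (λ z → ιₙ 2 ⊗ (√5 ⊗ z)) (∑-⊗ˡ (suc (n / 2)) (ιₙ (suc n)) t) ⟩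
    ιₙ 2 ⊗ (√5 ⊗ ∑ (suc (n / 2)) (λ k → ιₙ (suc n) ⊗ t k))  ≡⟨ cong (ιₙ 2 ⊗_) (∑-⊗ˡ (suc (n / 2)) √5 (λ k → ιₙ (suc n) ⊗ t k)) ⟩
    ιₙ 2 ⊗ ∑ (suc (n / 2)) (λ k → √5 ⊗ (ιₙ (suc n) ⊗ t k))  ≡⟨ cong (ιₙ 2 ⊗_) (∑-cong-< (suc (n / 2)) (λ k k<1+n/2 → term k (k<1+n/2⇒2k≤n n k k<1+n/2))) ⟨
    ιₙ 2 ⊗ ∑ (suc (n / 2)) (λ k → appellShiftTerm (suc n) B 𝟙 β d (2 ℕ.* k))
                                                            ≡⟨ appell-shift-even {B} bernoulli-recurrence n β d ⟩
    ιₙ (suc n) ⊗ (𝟙 ⊗ (d ⊗ (β ^ n ⊕ 𝟙 ⊗ (β ⊕ d) ^ n)))       ≡⟨ cong (λ a → ιₙ (suc n) ⊗ (𝟙 ⊗ (d ⊗ (β ^ n ⊕ 𝟙 ⊗ a ^ n))))  α≡β⊕d ⟨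
    ιₙ (suc n) ⊗ (𝟙 ⊗ (ι F ⊗ √5 ⊗ (β ^ n ⊕ 𝟙 ⊗ α ^ n)))     ≡⟨ collect (ιₙ (suc n)) (ι F) (α ^ n) (β ^ n) ⟩
    √5 ⊗ (ιₙ (suc n) ⊗ (ι F ⊗ (α ^ n ⊕ β ^ n)))              ≡⟨ cong (λ z → √5 ⊗ (ιₙ (suc n) ⊗ (ι F ⊗ z))) (α^⊕β^ n) ⟩
    √5 ⊗ (ιₙ (suc n) ⊗ (ι F ⊗ ιₙ (lucas (j ℕ.* n))))          ∎))
    where
    t : ℕ → ℚ√5
    t k = ι (coefficient₁ k * bernoulliPart₁ k)
    rotate : ∀ a b c s → a ⊗ (b ⊗ (c ⊗ s)) ≡ c ⊗ (a ⊗ (b ⊗ s))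
    rotate = solve-∀ ℚ√5-ring
    collect : ∀ m f a b → m ⊗ (𝟙 ⊗ (f ⊗ √5 ⊗ (b ⊕ 𝟙 ⊗ a))) ≡ √5 ⊗ (m ⊗ (f ⊗ (a ⊕ b)))
    collect = solve-∀ ℚ√5-ring
    collect-factors : ∀ s m c q e b → s ⊗ (m ⊗ ((c ⊗ q) ⊗ (e ⊗ b))) ≡ ((m ⊗ c) ⊗ e) ⊗ (b ⊗ (q ⊗ s))
    collect-factors = solve-∀ ℚ√5-ring
    move-√5 : ∀ c f b q s → (c ⊗ f) ⊗ (b ⊗ (q ⊗ s)) ≡ c ⊗ (b ⊗ (q ⊗ (f ⊗ s)))
    move-√5 = solve-∀ ℚ√5-ring
    term : ∀ k → 2 ℕ.* k ≤ n → appellShiftTerm (suc n) B 𝟙 β d (2 ℕ.* k) ≡ √5 ⊗ (ιₙ (suc n) ⊗ t k)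
    term k 2k≤n = sym (begin
      √5 ⊗ (ιₙ (suc n) ⊗ ι (⟦ n C i ⟧ * Q ^ℚ k * (D * bernoulli i)))
        ≡⟨ cong (λ z → √5 ⊗ (ιₙ (suc n) ⊗ z)) (trans (ι-* (⟦ n C i ⟧ * Q ^ℚ k) (D * bernoulli i))
             (cong₂ _⊗_ (trans (ι-* ⟦ n C i ⟧ (Q ^ℚ k)) (cong (ιₙ (n C i) ⊗_) (ι-^ Q k))) (ι-* D (bernoulli i)))) ⟩
      √5 ⊗ (ιₙ (suc n) ⊗ ((ιₙ (n C i) ⊗ ι Q ^ k) ⊗ (ι D ⊗ B i)))
        ≡⟨ collect-factors √5 (ιₙ (suc n)) (ιₙ (n C i)) (ι Q ^ k) (ι D) (B i) ⟩
      ((ιₙ (suc n) ⊗ ιₙ (n C i)) ⊗ ι D) ⊗ (B i ⊗ (ι Q ^ k ⊗ √5))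
        ≡⟨ cong (_⊗ (B i ⊗ (ι Q ^ k ⊗ √5))) (ιₙ-C-absorb n i (fib (j ℕ.* suc u)) 2k≤n) ⟩
      (ιₙ (suc n C i) ⊗ ιₙ (fib (j ℕ.* suc u))) ⊗ (B i ⊗ (ι Q ^ k ⊗ √5))
        ≡⟨ move-√5 (ιₙ (suc n C i)) (ιₙ (fib (j ℕ.* suc u))) (B i) (ι Q ^ k) √5 ⟩
      ιₙ (suc n C i) ⊗ (B i ⊗ (ι Q ^ k ⊗ (ιₙ (fib (j ℕ.* suc u)) ⊗ √5)))
        ≡⟨ cong₂ (λ p q → ιₙ (suc n C i) ⊗ (B i ⊗ (p ⊗ q))) d^2k (α^⊖β^ (suc u)) ⟨
      ιₙ (suc n C i) ⊗ (B i ⊗ (d ^ i ⊗ (α ^ suc u ⊕ ⊝ β ^ suc u)))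
        ≡⟨ cong (λ z → ιₙ (suc n C i) ⊗ (B i ⊗ (d ^ i ⊗ (α ^ suc u ⊕ ⊝ z)))) (⊗-identityˡ (β ^ suc u)) ⟨
      ιₙ (suc n C i) ⊗ (B i ⊗ (d ^ i ⊗ (α ^ suc u ⊕ ⊝ (𝟙 ⊗ β ^ suc u))))
        ≡⟨ cong₂ (λ a r → ιₙ (suc n C i) ⊗ (B i ⊗ (d ^ i ⊗ (a ^ r ⊕ ⊝ (𝟙 ⊗ β ^ r))))) α≡β⊕d (sym (ℕₚ.+-∸-assoc 1 2k≤n)) ⟩
      appellShiftTerm (suc n) B 𝟙 β d i ∎)
      where
      i = 2 ℕ.* k
      u = n ∸ i
      D = (+ fib (j ℕ.* suc u)) ℚ./ suc u
      d^2k : d ^ i ≡ ι Q ^ k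
      d^2k = trans (^-2* d k) (cong (_^ k) d⊗d≡ιQ)
[n+1]*nCk*[1/[k+1]]≡[n+1]C[k+1] : ∀ n k → (ιₙ (suc n) ⊗ ιₙ (n C k)) ⊗ ι (+ 1 ℚ./ suc k) ≡ ιₙ (suc n C suc k)
[n+1]*nCk*[1/[k+1]]≡[n+1]C[k+1] n k = begin
  (ιₙ (suc n) ⊗ ιₙ (n C k)) ⊗ ι k⁻¹                    ≡⟨ cong (_⊗ ι k⁻¹) (trans (cong ιₙ ([k+1]*[n+1]C[k+1]≡[n+1]*nCk n k)) (ιₙ-* (suc n) (n C k))) ⟨
  ιₙ (suc k ℕ.* (suc n C suc k)) ⊗ ι k⁻¹               ≡⟨ cong (_⊗ ι k⁻¹) (trans (ιₙ-* (suc k) (suc n C suc k)) (⊗-comm (ιₙ (suc k)) (ιₙ (suc n C suc k)))) ⟩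
  (ιₙ (suc n C suc k) ⊗ ιₙ (suc k)) ⊗ ι k⁻¹            ≡⟨ ⊗-assoc (ιₙ (suc n C suc k)) (ιₙ (suc k)) (ι k⁻¹) ⟩
  ιₙ (suc n C suc k) ⊗ (ιₙ (suc k) ⊗ ι k⁻¹)            ≡⟨ cong (ιₙ (suc n C suc k) ⊗_) (trans (⊗-comm (ιₙ (suc k)) (ι k⁻¹)) (ι[1/n]⊗ιₙn≡𝟙 (suc k))) ⟩
  ιₙ (suc n C suc k) ⊗ 𝟙                               ≡⟨ ⊗-identityʳ (ιₙ (suc n C suc k)) ⟩
  ιₙ (suc n C suc k)                                   ∎
  where k⁻¹ = + 1 ℚ./ suc k

genocchi-even : ∀ k → genocchi (2 ℕ.+ 2 ℕ.* k) ≡ ⊝ (ιₙ 2 ⊗ (ιₙ (4 ℕ.^ suc k ∸ 1) ⊗ B (2 ℕ.+ 2 ℕ.* k)))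
genocchi-even k = begin
  ιₙ 2 ⊗ ((𝟙 ⊕ ⊝ ιₙ 2 ^ (2 ℕ.+ 2 ℕ.* k)) ⊗ B i)     ≡⟨ cong (λ z → ιₙ 2 ⊗ ((𝟙 ⊕ ⊝ z) ⊗ B i)) 2^[2k+2]≡1+p ⟩
  ιₙ 2 ⊗ ((𝟙 ⊕ ⊝ (𝟙 ⊕ ιₙ p)) ⊗ B i)                 ≡⟨ simplify (ιₙ p) (B i) ⟩
  ⊝ (ιₙ 2 ⊗ (ιₙ p ⊗ B i))                          ∎
  where
  i = 2 ℕ.+ 2 ℕ.* k
  p = 4 ℕ.^ suc k ∸ 1
  simplify : ∀ q b → ιₙ 2 ⊗ ((𝟙 ⊕ ⊝ (𝟙 ⊕ q)) ⊗ b) ≡ ⊝ (ιₙ 2 ⊗ (q ⊗ b))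
  simplify = solve-∀ ℚ√5-ring
  2^[2k+2]≡1+p : ιₙ 2 ^ (2 ℕ.+ 2 ℕ.* k) ≡ 𝟙 ⊕ ιₙ p
  2^[2k+2]≡1+p = begin
    ιₙ 2 ^ (2 ℕ.+ 2 ℕ.* k)      ≡⟨ cong (ιₙ 2 ^_) (ℕₚ.*-suc 2 k) ⟨
    ιₙ 2 ^ (2 ℕ.* suc k)        ≡⟨ ^-2* (ιₙ 2) (suc k) ⟩
    ιₙ 4 ^ suc k                ≡⟨ ιₙ-^ 4 (suc k) ⟨
    ιₙ (4 ℕ.^ suc k)            ≡⟨ cong ιₙ (ℕₚ.suc-pred (4 ℕ.^ suc k) {{ℕₚ.m^n≢0 4 (suc k)}}) ⟨
    ιₙ (suc p)                  ≡⟨ ιₙ-+ 1 p ⟩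
    𝟙 ⊕ ιₙ p                    ∎

[n+2][n+1]nC2k*[1/[2k+1]]*[p/[k+1]]≡2*[n+2]C[2k+2]*p : ∀ n k p →
  ((ιₙ (suc (suc n)) ⊗ (ιₙ (suc n) ⊗ ιₙ (n C (2 ℕ.* k)))) ⊗ ι (+ 1 ℚ./ suc (2 ℕ.* k))) ⊗ ι ((+ p) ℚ./ suc k)
  ≡ ιₙ 2 ⊗ (ιₙ (suc (suc n) C (2 ℕ.+ 2 ℕ.* k)) ⊗ ιₙ p)
[n+2][n+1]nC2k*[1/[2k+1]]*[p/[k+1]]≡2*[n+2]C[2k+2]*p n k p = begin
  ((ιₙ (suc (suc n)) ⊗ (ιₙ (suc n) ⊗ ιₙ (n C i))) ⊗ ι (+ 1 ℚ./ suc i)) ⊗ ι P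
    ≡⟨ cong (_⊗ ι P) (⊗-assoc (ιₙ (suc (suc n))) (ιₙ (suc n) ⊗ ιₙ (n C i)) (ι (+ 1 ℚ./ suc i))) ⟩
  (ιₙ (suc (suc n)) ⊗ ((ιₙ (suc n) ⊗ ιₙ (n C i)) ⊗ ι (+ 1 ℚ./ suc i))) ⊗ ι P
    ≡⟨ cong (λ z → (ιₙ (suc (suc n)) ⊗ z) ⊗ ι P) ([n+1]*nCk*[1/[k+1]]≡[n+1]C[k+1] n i) ⟩
  (ιₙ (suc (suc n)) ⊗ ιₙ (suc n C suc i)) ⊗ ι P
    ≡⟨ cong (_⊗ ι P) (trans (cong ιₙ ([k+1]*[n+1]C[k+1]≡[n+1]*nCk (suc n) (suc i))) (ιₙ-* (suc (suc n)) (suc n C suc i))) ⟨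
  ιₙ (suc (suc i) ℕ.* (suc (suc n) C suc (suc i))) ⊗ ι P
    ≡⟨ cong (λ r → ιₙ (r ℕ.* (suc (suc n) C suc (suc i))) ⊗ ι P) (ℕₚ.*-suc 2 k) ⟨
  ιₙ (2 ℕ.* suc k ℕ.* (suc (suc n) C suc (suc i))) ⊗ ι P
    ≡⟨ cong (_⊗ ι P) (trans (ιₙ-* (2 ℕ.* suc k) c) (cong (_⊗ ιₙ c) (ιₙ-* 2 (suc k)))) ⟩
  ((ιₙ 2 ⊗ ιₙ (suc k)) ⊗ ιₙ (suc (suc n) C suc (suc i))) ⊗ ι P
    ≡⟨ regroup (ιₙ 2) (ιₙ (suc k)) (ιₙ (suc (suc n) C suc (suc i))) (ι P) ⟩
  ιₙ 2 ⊗ (ιₙ (suc (suc n) C suc (suc i)) ⊗ (ιₙ (suc k) ⊗ ι P))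
    ≡⟨ cong (λ z → ιₙ 2 ⊗ (ιₙ (suc (suc n) C suc (suc i)) ⊗ z))
         (trans (⊗-comm (ιₙ (suc k)) (ι P)) (trans (sym (ι-* P ⟦ suc k ⟧)) (cong ι (/-*-cancel p (suc k))))) ⟩
  ιₙ 2 ⊗ (ιₙ (suc (suc n) C suc (suc i)) ⊗ ιₙ p) ∎
  where
  i = 2 ℕ.* k
  P = (+ p) ℚ./ suc k
  c = suc (suc n) C suc (suc i)
  regroup : ∀ t s c q → ((t ⊗ s) ⊗ c) ⊗ q ≡ t ⊗ (c ⊗ (s ⊗ q))
  regroup = solve-∀ ℚ√5-ring

module _ (n j : ℕ) where
  open Binet j

  coefficient₂ bernoulliPart₂ lucasPart₂ : ℕ → ℚ
  coefficient₂ k = ⟦ n C (2 ℕ.* k) ⟧ * (Q ^ℚ k * (+ 1 ℚ./ suc (2 ℕ.* k)))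
  bernoulliPart₂ k = (((+ (4 ℕ.^ suc k ∸ 1)) ℚ./ suc k) * ⟦ lucas (j ℕ.* (n ∸ 2 ℕ.* k)) ⟧) * bernoulli (suc (suc (2 ℕ.* k)))
  lucasPart₂ k = L ^ℚ (n ∸ 2 ℕ.* k) * ½ ^ℚ n

  lucas-fibonacci-sum : ιₙ (suc n) ⊗ (ι F ⊗ ∑ (suc (n / 2)) (λ k → ι (coefficient₂ k * lucasPart₂ k))) ≡ ιₙ (fib (j ℕ.* suc n))
  lucas-fibonacci-sum = √5-cancelˡ (begin
    √5 ⊗ (ιₙ (suc n) ⊗ (ι F ⊗ ∑ (suc (n / 2)) t))         ≡⟨ pull-out √5 (ιₙ (suc n)) (ι F) (∑ (suc (n / 2)) t) ⟩
    K ⊗ ∑ (suc (n / 2)) t                                 ≡⟨ ∑-⊗ˡ (suc (n / 2)) K t ⟩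
    ∑ (suc (n / 2)) (λ k → K ⊗ t k)                       ≡⟨ ∑-cong-< (suc (n / 2)) (λ k k<1+n/2 → term k (k<1+n/2⇒2k≤n n k k<1+n/2)) ⟩
    ∑ (suc (n / 2)) (λ k → ιₙ 2 ⊗ T k)                    ≡⟨ ∑-⊗ˡ (suc (n / 2)) (ιₙ 2) T ⟨
    ιₙ 2 ⊗ ∑ (suc (n / 2)) T                              ≡⟨ binomial-odd h X n ⟨
    (h ⊕ X) ^ suc n ⊕ ⊝ (⊝ h ⊕ X) ^ suc n                 ≡⟨ cong₂ (λ a b → a ^ suc n ⊕ ⊝ b ^ suc n) α≡½d⊕½L β≡⊝½d⊕½L ⟨
    α ^ suc n ⊕ ⊝ β ^ suc n                               ≡⟨ α^⊖β^ (suc n) ⟩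
    ιₙ (fib (j ℕ.* suc n)) ⊗ √5                           ≡⟨ ⊗-comm (ιₙ (fib (j ℕ.* suc n))) √5 ⟩
    √5 ⊗ ιₙ (fib (j ℕ.* suc n))                           ∎)
    where
    h X K : ℚ√5
    h = half ⊗ d
    X = half ⊗ ι L
    K = ιₙ (suc n) ⊗ d
    t T : ℕ → ℚ√5
    t k = ι (coefficient₂ k * lucasPart₂ k)
    T k = ιₙ (suc n C suc (2 ℕ.* k)) ⊗ ((h ⊗ (h ⊗ h) ^ k) ⊗ X ^ (n ∸ 2 ℕ.* k))
    pull-out : ∀ s m f x → s ⊗ (m ⊗ (f ⊗ x)) ≡ (m ⊗ (f ⊗ s)) ⊗ x
    pull-out = solve-∀ ℚ√5-ring
    regroup : ∀ m d c q i l p → (m ⊗ d) ⊗ ((c ⊗ (q ⊗ i)) ⊗ (l ⊗ p)) ≡ ((m ⊗ c) ⊗ i) ⊗ (d ⊗ (p ⊗ (q ⊗ l)))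
    regroup = solve-∀ ℚ√5-ring
    double-half : ∀ c d p → c ⊗ (d ⊗ p) ≡ ιₙ 2 ⊗ (c ⊗ ((half ⊗ d) ⊗ p))
    double-half = solve-∀ ℚ√5-ring
    term : ∀ k → 2 ℕ.* k ≤ n → K ⊗ t k ≡ ιₙ 2 ⊗ T k
    term k 2k≤n = begin
      K ⊗ ι (⟦ n C i ⟧ * (Q ^ℚ k * I) * (L ^ℚ u * ½ ^ℚ n))
        ≡⟨ cong (K ⊗_) (trans (ι-* (⟦ n C i ⟧ * (Q ^ℚ k * I)) (L ^ℚ u * ½ ^ℚ n))
             (cong₂ _⊗_ (trans (ι-* ⟦ n C i ⟧ (Q ^ℚ k * I)) (cong (ιₙ (n C i) ⊗_) (trans (ι-* (Q ^ℚ k) I) (cong (_⊗ ι I) (ι-^ Q k)))))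
                        (trans (ι-* (L ^ℚ u) (½ ^ℚ n)) (cong₂ _⊗_ (ι-^ L u) (ι-^ ½ n))))) ⟩
      K ⊗ ((ιₙ (n C i) ⊗ (ι Q ^ k ⊗ ι I)) ⊗ (ι L ^ u ⊗ half ^ n))
        ≡⟨ regroup (ιₙ (suc n)) d (ιₙ (n C i)) (ι Q ^ k) (ι I) (ι L ^ u) (half ^ n) ⟩
      ((ιₙ (suc n) ⊗ ιₙ (n C i)) ⊗ ι I) ⊗ (d ⊗ (half ^ n ⊗ (ι Q ^ k ⊗ ι L ^ u)))
        ≡⟨ cong (_⊗ (d ⊗ (half ^ n ⊗ (ι Q ^ k ⊗ ι L ^ u)))) ([n+1]*nCk*[1/[k+1]]≡[n+1]C[k+1] n i) ⟩
      ιₙ (suc n C suc i) ⊗ (d ⊗ (half ^ n ⊗ (ι Q ^ k ⊗ ι L ^ u)))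
        ≡⟨ cong₂ (λ r q → ιₙ (suc n C suc i) ⊗ (d ⊗ (half ^ r ⊗ (q ^ k ⊗ ι L ^ u)))) (sym (ℕₚ.m+[n∸m]≡n 2k≤n)) (sym d⊗d≡ιQ) ⟩
      ιₙ (suc n C suc i) ⊗ (d ⊗ (half ^ (i ℕ.+ u) ⊗ ((d ⊗ d) ^ k ⊗ ι L ^ u)))
        ≡⟨ cong (λ z → ιₙ (suc n C suc i) ⊗ (d ⊗ z)) (scaled-powers half d (ι L) k u) ⟨
      ιₙ (suc n C suc i) ⊗ (d ⊗ ((h ⊗ h) ^ k ⊗ X ^ u))
        ≡⟨ double-half (ιₙ (suc n C suc i)) d ((h ⊗ h) ^ k ⊗ X ^ u) ⟩
      ιₙ 2 ⊗ (ιₙ (suc n C suc i) ⊗ (h ⊗ ((h ⊗ h) ^ k ⊗ X ^ u)))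
        ≡⟨ cong (λ z → ιₙ 2 ⊗ (ιₙ (suc n C suc i) ⊗ z)) (⊗-assoc h ((h ⊗ h) ^ k) (X ^ u)) ⟨
      ιₙ 2 ⊗ T k ∎
      where
      i = 2 ℕ.* k
      u = n ∸ i
      I = + 1 ℚ./ suc i

  genocchi-lucas-sum : .{{_ : NonZero (fib j)}} →
    ιₙ (suc n) ⊗ (ι F ⊗ ∑ (suc (n / 2)) (λ k → ι (coefficient₂ k * bernoulliPart₂ k))) ≡ ιₙ (fib (j ℕ.* suc n))
  genocchi-lucas-sum = √5-cancelˡ (√5-cancelˡ (ιₙ-cancelˡ (fib j) (ιₙ-cancelˡ M (ιₙ-cancelˡ 2 (begin
    ιₙ 2 ⊗ (ιₙ M ⊗ (ι F ⊗ (√5 ⊗ (√5 ⊗ (ιₙ (suc n) ⊗ (ι F ⊗ ∑ (suc (n / 2)) t))))))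
      ≡⟨ regroup (ιₙ 2) (ιₙ M) (ι F) √5 (ιₙ (suc n)) (∑ (suc (n / 2)) t) ⟩
    ⊝ (ιₙ 2 ⊗ ⊝ (K ⊗ ∑ (suc (n / 2)) t))
      ≡⟨ cong (λ z → ⊝ (ιₙ 2 ⊗ z)) (trans (cong ⊝_ (∑-⊗ˡ (suc (n / 2)) K t)) (sym (∑-⊝ (suc (n / 2)) (λ k → K ⊗ t k)))) ⟩
    ⊝ (ιₙ 2 ⊗ ∑ (suc (n / 2)) (λ k → ⊝ (K ⊗ t k)))
      ≡⟨ cong (λ z → ⊝ (ιₙ 2 ⊗ z)) (∑-cong-< (suc (n / 2)) (λ k k<1+n/2 → term k (k<1+n/2⇒2k≤n n k k<1+n/2))) ⟨
    ⊝ (ιₙ 2 ⊗ ∑ (suc (n / 2)) (λ k → appellShiftTerm M genocchi (⊝ 𝟙) β d (2 ℕ.+ 2 ℕ.* k)))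
      ≡⟨ cong ⊝_ (appell-shift-even-from-2 {genocchi} genocchi-recurrence refl refl n β d) ⟩
    ⊝ (ιₙ M ⊗ (ιₙ 2 ⊗ (d ⊗ (β ^ suc n ⊕ ⊝ 𝟙 ⊗ (β ⊕ d) ^ suc n))))
      ≡⟨ cong (λ a → ⊝ (ιₙ M ⊗ (ιₙ 2 ⊗ (d ⊗ (β ^ suc n ⊕ ⊝ 𝟙 ⊗ a ^ suc n))))) α≡β⊕d ⟨
    ⊝ (ιₙ M ⊗ (ιₙ 2 ⊗ (ι F ⊗ √5 ⊗ (β ^ suc n ⊕ ⊝ 𝟙 ⊗ α ^ suc n))))
      ≡⟨ flip-sign (ιₙ M) (ι F) (α ^ suc n) (β ^ suc n) ⟩
    ιₙ 2 ⊗ (ιₙ M ⊗ (ι F ⊗ (√5 ⊗ (α ^ suc n ⊕ ⊝ β ^ suc n))))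
      ≡⟨ cong (λ z → ιₙ 2 ⊗ (ιₙ M ⊗ (ι F ⊗ (√5 ⊗ z)))) (trans (α^⊖β^ (suc n)) (⊗-comm (ιₙ (fib (j ℕ.* suc n))) √5)) ⟩
    ιₙ 2 ⊗ (ιₙ M ⊗ (ι F ⊗ (√5 ⊗ (√5 ⊗ ιₙ (fib (j ℕ.* suc n)))))) ∎)))))
    where
    M = suc (suc n)
    K : ℚ√5
    K = (d ⊗ d) ⊗ (ιₙ M ⊗ ιₙ (suc n))
    t : ℕ → ℚ√5
    t k = ι (coefficient₂ k * bernoulliPart₂ k)
    regroup : ∀ a m f s n x → a ⊗ (m ⊗ (f ⊗ (s ⊗ (s ⊗ (n ⊗ (f ⊗ x)))))) ≡ ⊝ (a ⊗ ⊝ ((((f ⊗ s) ⊗ (f ⊗ s)) ⊗ (m ⊗ n)) ⊗ x))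
    regroup = solve-∀ ℚ√5-ring
    flip-sign : ∀ m f a b → ⊝ (m ⊗ (ιₙ 2 ⊗ (f ⊗ √5 ⊗ (b ⊕ ⊝ 𝟙 ⊗ a)))) ≡ ιₙ 2 ⊗ (m ⊗ (f ⊗ (√5 ⊗ (a ⊕ ⊝ b))))
    flip-sign = solve-∀ ℚ√5-ring
    rearrange : ∀ c g p b e q l → c ⊗ (⊝ (g ⊗ (p ⊗ b)) ⊗ (e ⊗ (e ⊗ q) ⊗ l)) ≡ ⊝ ((g ⊗ (c ⊗ p)) ⊗ ((e ⊗ e) ⊗ (q ⊗ (l ⊗ b))))
    rearrange = solve-∀ ℚ√5-ring
    rearrange′ : ∀ e m n c i p q l b → ⊝ ((((m ⊗ (n ⊗ c)) ⊗ i) ⊗ p) ⊗ ((e ⊗ e) ⊗ (q ⊗ (l ⊗ b))))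
                                      ≡ ⊝ (((e ⊗ e) ⊗ (m ⊗ n)) ⊗ ((c ⊗ (q ⊗ i)) ⊗ ((p ⊗ l) ⊗ b)))
    rearrange′ = solve-∀ ℚ√5-ring
    unsign : ∀ x y → x ⊕ ⊝ (⊝ 𝟙 ⊗ y) ≡ x ⊕ y
    unsign = solve-∀ ℚ√5-ring
    term : ∀ k → 2 ℕ.* k ≤ n → appellShiftTerm M genocchi (⊝ 𝟙) β d (2 ℕ.+ 2 ℕ.* k) ≡ ⊝ (K ⊗ t k)
    term k 2k≤n = begin
      ιₙ (M C i′) ⊗ (genocchi i′ ⊗ (d ⊗ (d ⊗ d ^ i) ⊗ ((β ⊕ d) ^ u ⊕ ⊝ (⊝ 𝟙 ⊗ β ^ u))))
        ≡⟨ cong₂ (λ q a → ιₙ (M C i′) ⊗ (genocchi i′ ⊗ (d ⊗ (d ⊗ q) ⊗ a))) (trans (^-2* d k) (cong (_^ k) d⊗d≡ιQ))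
                 (trans (unsign ((β ⊕ d) ^ u) (β ^ u)) (trans (cong (λ a → a ^ u ⊕ β ^ u) (sym α≡β⊕d)) (α^⊕β^ u))) ⟩
      ιₙ (M C i′) ⊗ (genocchi i′ ⊗ (d ⊗ (d ⊗ ι Q ^ k) ⊗ ιₙ (lucas (j ℕ.* u))))
        ≡⟨ cong (λ g → ιₙ (M C i′) ⊗ (g ⊗ (d ⊗ (d ⊗ ι Q ^ k) ⊗ ιₙ (lucas (j ℕ.* u))))) (genocchi-even k) ⟩
      ιₙ (M C i′) ⊗ (⊝ (ιₙ 2 ⊗ (ιₙ p ⊗ B i′)) ⊗ (d ⊗ (d ⊗ ι Q ^ k) ⊗ ιₙ (lucas (j ℕ.* u))))
        ≡⟨ rearrange (ιₙ (M C i′)) (ιₙ 2) (ιₙ p) (B i′) d (ι Q ^ k) (ιₙ (lucas (j ℕ.* u))) ⟩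
      ⊝ ((ιₙ 2 ⊗ (ιₙ (M C i′) ⊗ ιₙ p)) ⊗ R)
        ≡⟨ cong (λ z → ⊝ (z ⊗ R)) ([n+2][n+1]nC2k*[1/[2k+1]]*[p/[k+1]]≡2*[n+2]C[2k+2]*p n k p) ⟨
      ⊝ ((((ιₙ M ⊗ (ιₙ (suc n) ⊗ ιₙ (n C i))) ⊗ ι I) ⊗ ι P) ⊗ R)
        ≡⟨ rearrange′ d (ιₙ M) (ιₙ (suc n)) (ιₙ (n C i)) (ι I) (ι P) (ι Q ^ k) (ιₙ (lucas (j ℕ.* u))) (B i′) ⟩
      ⊝ (K ⊗ ((ιₙ (n C i) ⊗ (ι Q ^ k ⊗ ι I)) ⊗ ((ι P ⊗ ιₙ (lucas (j ℕ.* u))) ⊗ B i′)))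
        ≡⟨ cong (λ z → ⊝ (K ⊗ z)) (trans (ι-* (⟦ n C i ⟧ * (Q ^ℚ k * I)) ((P * ⟦ lucas (j ℕ.* u) ⟧) * bernoulli i′))
             (cong₂ _⊗_ (trans (ι-* ⟦ n C i ⟧ (Q ^ℚ k * I)) (cong (ιₙ (n C i) ⊗_) (trans (ι-* (Q ^ℚ k) I) (cong (_⊗ ι I) (ι-^ Q k)))))
                        (trans (ι-* (P * ⟦ lucas (j ℕ.* u) ⟧) (bernoulli i′)) (cong (_⊗ B i′) (ι-* P ⟦ lucas (j ℕ.* u) ⟧))))) ⟨
      ⊝ (K ⊗ t k) ∎
      where
      i = 2 ℕ.* k
      i′ = 2 ℕ.+ i
      u = n ∸ i
      p = 4 ℕ.^ suc k ∸ 1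
      I = + 1 ℚ./ suc i
      P = (+ p) ℚ./ suc k
      R = (d ⊗ d) ⊗ (ι Q ^ k ⊗ (ιₙ (lucas (j ℕ.* u)) ⊗ B i′))
Σ[0…]-*-∸≡0 : ∀ N (a b c : ℕ → ℚ) → ∑ (suc N) (λ k → ι (a k * b k)) ≡ ∑ (suc N) (λ k → ι (a k * c k)) →
  Σ[0… N ] (λ k → a k * (b k - c k)) ≡ 0ℚ
Σ[0…]-*-∸≡0 N a b c eq = ι-injective (begin
  ι (Σ[0… N ] (λ k → a k * (b k - c k)))                      ≡⟨ ι-Σ[0…] N (λ k → a k * (b k - c k)) ⟩
  ∑ (suc N) (λ k → ι (a k * (b k - c k)))                      ≡⟨ ∑-cong (suc N) distrib ⟩
  ∑ (suc N) (λ k → ι (a k * b k) ⊕ ⊝ ι (a k * c k))            ≡⟨ ∑-⊖ (suc N) (λ k → ι (a k * b k)) (λ k → ι (a k * c k)) ⟩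
  ∑ (suc N) (λ k → ι (a k * b k)) ⊕ ⊝ ∑ (suc N) (λ k → ι (a k * c k))
                                                               ≡⟨ cong (_⊕ ⊝ ∑ (suc N) (λ k → ι (a k * c k))) eq ⟩
  ∑ (suc N) (λ k → ι (a k * c k)) ⊕ ⊝ ∑ (suc N) (λ k → ι (a k * c k))
                                                               ≡⟨ cancel (∑ (suc N) (λ k → ι (a k * c k))) ⟩
  ι 0ℚ                                                         ∎)
  where
  cancel : ∀ x → x ⊕ ⊝ x ≡ 𝟘
  cancel = solve-∀ ℚ√5-ring
  expand : ∀ x y z → x ⊗ (y ⊕ ⊝ z) ≡ x ⊗ y ⊕ ⊝ (x ⊗ z)
  expand = solve-∀ ℚ√5-ring
  distrib : ∀ k → ι (a k * (b k - c k)) ≡ ι (a k * b k) ⊕ ⊝ ι (a k * c k)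
  distrib k = begin
    ι (a k * (b k - c k))                 ≡⟨ ι-* (a k) (b k - c k) ⟩
    ι (a k) ⊗ (ι (b k) ⊕ ⊝ ι (c k))       ≡⟨ expand (ι (a k)) (ι (b k)) (ι (c k)) ⟩
    ι (a k) ⊗ ι (b k) ⊕ ⊝ (ι (a k) ⊗ ι (c k)) ≡⟨ cong₂ (λ p q → p ⊕ ⊝ q) (ι-* (a k) (b k)) (ι-* (a k) (c k)) ⟨
    ι (a k * b k) ⊕ ⊝ ι (a k * c k)       ∎

0<fib[1+j] : ∀ j → 0 < fib (suc j)
0<fib[1+j] zero = s≤s z≤n
0<fib[1+j] (suc j) = ℕₚ.<-≤-trans (0<fib[1+j] j) (ℕₚ.m≤m+n (fib (suc j)) (fib j))

-- The identities also hold for n = 0.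
theorem5 : (n j : ℕ) → .{{_ : NonZero n}} → .{{_ : NonZero j}} →
    (Σ[0… n / 2 ] (λ k → ⟦ n C (2 Data.Nat.* k) ⟧ * ((⟦ 5 ⟧ * (⟦ fib j ⟧ ^ℚ 2)) ^ℚ k)
        * (((+ fib (j Data.Nat.* suc (n ∸ 2 Data.Nat.* k))) Data.Rational./ suc (n ∸ 2 Data.Nat.* k)) * bernoulli (2 Data.Nat.* k)
           - ⟦ fib j ⟧ * (⟦ lucas j ⟧ ^ℚ (n ∸ 2 Data.Nat.* k)) * ((+ 1 Data.Rational./ 2) ^ℚ n))) ≡ 0ℚ)
    ×
    (Σ[0… n / 2 ] (λ k → ⟦ n C (2 Data.Nat.* k) ⟧ * (((⟦ 5 ⟧ * (⟦ fib j ⟧ ^ℚ 2)) ^ℚ k) * (+ 1 Data.Rational./ suc (2 Data.Nat.* k)))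
        * ((((+ (4 Data.Nat.^ suc k Data.Nat.∸ 1)) Data.Rational./ suc k) * ⟦ lucas (j Data.Nat.* (n ∸ 2 Data.Nat.* k)) ⟧) * bernoulli (suc (suc (2 Data.Nat.* k)))
           - (⟦ lucas j ⟧ ^ℚ (n ∸ 2 Data.Nat.* k)) * ((+ 1 Data.Rational./ 2) ^ℚ n))) ≡ 0ℚ)
theorem5 n j@(suc j-1) =
    Σ[0…]-*-∸≡0 (n / 2) (coefficient₁ n j) (bernoulliPart₁ n j) (lucasPart₁ n j)
      (ιₙ-cancelˡ 2 (trans (bernoulli-fibonacci-sum n j) (sym (lucas-power-sum n j))))
  , Σ[0…]-*-∸≡0 (n / 2) (coefficient₂ n j) (bernoulliPart₂ n j) (lucasPart₂ n j)
      (ιₙ-cancelˡ (fib j) (ιₙ-cancelˡ (suc n) (trans (genocchi-lucas-sum n j) (sym (lucas-fibonacci-sum n j)))))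
  where instance _ = ℕ.>-nonZero (0<fib[1+j] j-1)
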